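{- Let $I_{\mathrm{Lam}}^{\mathrm{st},k}:=\mathcal{U}\cap J_{\mathrm{Lam}}^{\mathrm{st},k}$. The nonzero equivalence classes of $\mathcal{U}/I_{\mathrm{Lam}}^{\mathrm{st},k}$ are exactly the sets $\{v\in\mathcal{W}^{(k)}(\boldsymbol\beta):\mathrm{inv}_k(v)=t\}$, where $\boldsymbol\beta$ ranges over $k$-tuples of skew shapes with contents such that each $\beta^{(i)}$ contains no $2\times2$ square and has shifted contents in $[N]$, and $t\in\mathbb{N}$ ranges over values for which this set is nonempty.
   Context: $\mathcal{U}=\mathbb{Z}\langle u_1,\dots,u_N\rangle$ (letter $a$ = $u_a$), regarded as the subring of $\mathcal{U}_q=\mathbb{Q}(q)\otimes_{\mathbb{Z}}\mathcal{U}$ generated over $\mathbb{Z}$ by the $u_i$. $J_{\mathrm{Lam}}^{\mathrm{st},k}$ is the two-sided ideal of $\mathcal{U}_q$ generated by $ac-ca$ for $c-a>k$, $ab-q^{ -1}ba$ for $0<b-a<k$, and all words with a repeated letter. For an ideal $I$ of $\mathcal{U}$, two words $v,w$ are equivalent if $v-w\in I$; a word is nonzero if it is not in $I$; an equivalence class is nonzero if all its elements are nonzero. Skew shapes in English convention; content of cell $(r,c)$ is $c-r$; skew shapes with contents are taken up to content- and order-preserving bijection. For $\boldsymbol\beta=(\beta^{(0)},\dots,\beta^{(k-1)})$, the shifted content of a cell $z\in\beta^{(i)}$ is $k\,c(z)+i$. $\mathcal{W}^{(k)}(\boldsymbol\beta)$ is the set of rearrangements $v$ of the shifted contents of $\boldsymbol\beta$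 such that for each $i$ and cells $z,z'$ of $\beta^{(i)}$ with $z'$ immediately east or immediately south of $z$, $\tilde c(z)$ occurs before $\tilde c(z')$ in $v$. $\mathrm{inv}_k(v)=|\{(i,j):i<j,\ 0<v_i-v_j<k\}|$. -}

module Defs where

open import Data.Nat as ℕ using (ℕ; zero; suc; _<_; _≤_; _≥_; _∸_)
open import Data.Integer as ℤ using (ℤ; +_; -[1+_])
open import Data.Rational as ℚ using (ℚ; 0ℚ; 1ℚ)
open import Data.Fin as Fin using (Fin; toℕ)
open import Data.List using (List; []; _∷_; _++_; map; concatMap; concat; filter; length; upTo; lookup)
open import Data.List.Properties using (≡-dec)
open import Data.List.Relation.Unary.Linked using (Linked)
open import Data.List.Membership.Propositional using (_∈_)
open import Data.List.Relation.Binary.Permutation.Propositional using (_↭_)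
open import Data.List.Base using (allFin)
open import Data.Product using (Σ; _×_; _,_; ∃; ∃-syntax)
open import Data.Sum using (_⊎_)
open import Relation.Binary.PropositionalEquality using (_≡_; _≢_)
open import Relation.Nullary using (¬_; yes; no)
open import Relation.Nullary.Decidable using (_×-dec_)
open import Function.Bundles using (_⇔_)

-- Words in the letters u_1 … u_N.  The letter u_a is represented by
-- the element of Fin N with toℕ = a - 1.

Word : ℕ → Set
Word N = List (Fin N)

val : {N : ℕ} → Fin N → ℕ
val a = suc (toℕ a)

valℤ : {N : ℕ} → Fin N → ℤ
valℤ a = + val a

-- Elements of ℚ[q,q⁻¹]⟨u_1,…,u_N⟩ ⊆ U_q as formal ℚ-linear
-- combinations of monomials  c · q^e · w  (c ∈ ℚ, e ∈ ℤ, w a word).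

Term : ℕ → Set
Term N = ℚ × ℤ × Word N

LinComb : ℕ → Set
LinComb N = List (Term N)

coeff : {N : ℕ} → LinComb N → ℤ → Word N → ℚ
coeff [] e w = 0ℚ
coeff ((c , e′ , w′) ∷ xs) e w with e′ ℤ.≟ e | ≡-dec Fin._≟_ w′ w
... | yes _ | yes _ = c ℚ.+ coeff xs e w
... | _     | _     = coeff xs e w

_≋_ : {N : ℕ} → LinComb N → LinComb N → Set
xs ≋ ys = ∀ e w → coeff xs e w ≡ coeff ys e w

word : {N : ℕ} → Word N → LinComb N
word w = (1ℚ , + 0 , w) ∷ []

_⊖_ : {N : ℕ} → Word N → Word N → LinComb N
v ⊖ w = (1ℚ , + 0 , v) ∷ (ℚ.- 1ℚ , + 0 , w) ∷ []

HasRepeat : {N : ℕ} → Word N → Set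
HasRepeat {N} w = ∃[ a ] ∃[ p ] ∃[ m ] ∃[ s ] (w ≡ p ++ a ∷ m ++ a ∷ s)

data Gen (N k : ℕ) : LinComb N → Set where
  comm  : (a c : Fin N) → val a ℕ.+ k < val c →
          Gen N k ((1ℚ , + 0 , a ∷ c ∷ []) ∷ (ℚ.- 1ℚ , + 0 , c ∷ a ∷ []) ∷ [])
  qcomm : (a b : Fin N) → val a < val b → val b < val a ℕ.+ k →
          Gen N k ((1ℚ , + 0 , a ∷ b ∷ []) ∷ (ℚ.- 1ℚ , -[1+ 0 ] , b ∷ a ∷ []) ∷ [])
  rep   : (w : Word N) → HasRepeat w → Gen N k ((1ℚ , + 0 , w) ∷ [])

-- one summand  c · q^e · x · g · y  of an element of the two-sided ideal
record GenInst (N k : ℕ) : Set where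
  field
    coef  : ℚ
    expo  : ℤ
    left  : Word N
    gen   : LinComb N
    isGen : Gen N k gen
    right : Word N

expand : {N k : ℕ} → GenInst N k → LinComb N
expand g = map (λ { (c , e , w) → (coef ℚ.* c , expo ℤ.+ e , left ++ w ++ right) }) gen
  where open GenInst g

-- Laurent polynomials D ∈ ℚ[q,q⁻¹] as lists of monomials c·q^e
LPoly : Set
LPoly = List (ℚ × ℤ)

pcoeff : LPoly → ℤ → ℚ
pcoeff [] e = 0ℚ
pcoeff ((c , e′) ∷ xs) e with e′ ℤ.≟ e
... | yes _ = c ℚ.+ pcoeff xs e
... | no  _ = pcoeff xs e

NonzeroLP : LPoly → Set
NonzeroLP D = ∃[ e ] (pcoeff D e ≢ 0ℚ)

scale : {N : ℕ} → LPoly → LinComb N → LinComb N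
scale D f = concatMap (λ { (c , e) → map (λ { (c′ , e′ , w) → (c ℚ.* c′ , e ℤ.+ e′ , w) }) f }) D

-- Membership in the two-sided ideal J^{st,k}_Lam of U_q = ℚ(q) ⊗ U,
-- for an element f with coefficients in ℚ[q,q⁻¹].  An element of J is a
-- finite sum Σ r_i x_i g_i y_i with r_i ∈ ℚ(q); clearing denominators,
-- f ∈ J  iff  D·f is a ℚ[q,q⁻¹]-combination of the x g y for some
-- nonzero D ∈ ℚ[q,q⁻¹].
InJ : (N k : ℕ) → LinComb N → Set
InJ N k f = Σ LPoly λ D → NonzeroLP D × Σ (List (GenInst N k)) λ gs → concatMap expand gs ≋ scale D f

-- I = U ∩ J.  Elements v - w and w (for words v, w) lie in U, so
-- membership in I is membership in J.
NonzeroWord : (N k : ℕ) → Word N → Set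
NonzeroWord N k w = ¬ InJ N k (word w)

IsNonzeroClass : (N k : ℕ) → (Word N → Set) → Set
IsNonzeroClass N k C =
  (∃[ w ] ∀ v → C v ⇔ InJ N k (v ⊖ w)) × (∀ v → C v → NonzeroWord N k v)

-- Skew shapes λ/μ (English convention, rows and columns 0-indexed;
-- the content c - r is the same as with 1-indexing).

part : List ℕ → ℕ → ℕ
part []       r       = 0
part (x ∷ xs) zero    = x
part (x ∷ xs) (suc r) = part xs r

record SkewShape : Set where
  field
    outer     : List ℕ
    inner     : List ℕ
    outerPart : Linked _≥_ outer
    innerPart : Linked _≥_ inner
    contained : ∀ r → part inner r ≤ part outer r

Cell : Set
Cell = ℕ × ℕ   -- (row , column)

_∈S_ : Cell → SkewShape → Set
(r , c) ∈S sh = part inner r ≤ c × c < part outer r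
  where open SkewShape sh

cells : SkewShape → List Cell
cells sh = concatMap (λ r → map (λ j → (r , part inner r ℕ.+ j)) (upTo (part outer r ∸ part inner r)))
                     (upTo (length outer))
  where open SkewShape sh

content : Cell → ℤ
content (r , c) = + c ℤ.- + r

shc : (k : ℕ) → Fin k → Cell → ℤ
shc k i z = + k ℤ.* content z ℤ.+ + toℕ i

No2x2 : SkewShape → Set
No2x2 sh = ∀ r c → ¬ ((r , c) ∈S sh × (r , suc c) ∈S sh × (suc r , c) ∈S sh × (suc r , suc c) ∈S sh)

Admissible : (N k : ℕ) → (Fin k → SkewShape) → Set
Admissible N k β = ∀ i → No2x2 (β i) ×
  (∀ z → z ∈S β i → (+ 1 ℤ.≤ shc k i z) × (shc k i z ℤ.≤ + N))

shiftedContents : (k : ℕ) → (Fin k → SkewShape) → List ℤ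
shiftedContents k β = concatMap (λ i → map (shc k i) (cells (β i))) (allFin k)

Adjacent : Cell → Cell → Set
Adjacent (r , c) (r′ , c′) = (r′ ≡ r × c′ ≡ suc c) ⊎ (r′ ≡ suc r × c′ ≡ c)

OccursBefore : ℤ → ℤ → List ℤ → Set
OccursBefore x y ws = ∃[ p ] ∃[ s ] (ws ≡ p ++ x ∷ s × y ∈ s)

InW : (N k : ℕ) → (Fin k → SkewShape) → Word N → Set
InW N k β v = (map valℤ v ↭ shiftedContents k β) ×
  (∀ i z z′ → z ∈S β i → z′ ∈S β i → Adjacent z z′ →
     OccursBefore (shc k i z) (shc k i z′) (map valℤ v))

inv : {N : ℕ} → ℕ → Word N → ℕ
inv k [] = 0
inv k (a ∷ v) = length (filter (λ b → (val b ℕ.<? val a) ×-dec (val a ℕ.<? val b ℕ.+ k)) v) ℕ.+ inv k v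

-- Modulo the ideal, two adjacent letters whose values are not exactly k apart commute up to the power of q
-- that records the change of inv_k, and a word with a repeated letter vanishes. So a distinct word u is
-- congruent to q^(inv_k u − inv_k v) v whenever v rearranges u keeping the relative order of any two letters
-- k apart. Conversely, for each such class and each e, the functional reading off the coefficient of
-- q^(e − inv_k v) v over the words v of the class kills every generator; pairing it with a relation
-- D·(u − v) ∈ J, D a nonzero Laurent polynomial, forces u and v into one class with equal inv_k, since a
-- nonzero D has no nontrivial period. Finally these classes are the sets W^(k)(β): placing the letter of
-- value k c + i of a distinct word w at content c of the i-th ribbon, with an east step from c to c + 1
-- exactly when that letter precedes the next one in w, yields an admissible β with w ∈ W^(k)(β), and the
-- letters k apart are precisely those in adjacent cells, whose order W^(k)(β) prescribes.

module Submission where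

open import Defs

open import Algebra.Bundles using (AbelianGroup; CommutativeMonoid)
open import Data.Fin as Fin using (Fin; toℕ)
import Data.Fin.Properties as FinP
open import Data.Integer as ℤ using (ℤ; +_; -[1+_])
import Data.Integer.Properties as ℤP
import Data.Integer.Tactic.RingSolver as ℤSolver
open import Data.List using (List; []; _∷_; _++_; map; concatMap; filter; length; upTo; allFin; applyUpTo)
import Data.List.Properties as LP
open import Data.List.Membership.Propositional using (_∈_; _∉_; find; lose)
import Data.List.Membership.Propositional.Properties as ∈P
open import Data.List.Membership.Propositional.Properties.WithK using (unique∧set⇒bag)
open import Data.List.Relation.Binary.BagAndSetEquality using (∼bag⇒↭)
open import Data.List.Relation.Binary.Disjoint.Propositional using (Disjoint)
open import Data.List.Relation.Binary.Permutation.Propositional as ↭ using (_↭_; ↭⇒↭ₛ)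
import Data.List.Relation.Binary.Permutation.Propositional.Properties as ↭P
import Data.List.Relation.Binary.Permutation.Setoid.Properties as ↭ₛP
open import Data.List.Relation.Binary.Subset.Propositional using (_⊆_)
import Data.List.Relation.Binary.Subset.Propositional.Properties as ⊆P
import Data.List.Relation.Binary.Subset.DecPropositional as SubsetDec
open import Data.List.Relation.Unary.All as All using (All; []; _∷_)
import Data.List.Relation.Unary.All.Properties as AllP
import Data.List.Relation.Unary.AllPairs as AllPairs
open AllPairs using ([]; _∷_)
import Data.List.Relation.Unary.AllPairs.Properties as AllPairsP
open import Data.List.Relation.Unary.Any using (Any; here; there; any?)
import Data.List.Relation.Unary.Any.Properties as AnyP
import Data.List.Relation.Unary.Linked as Linked
open import Data.List.Relation.Unary.Unique.Propositional using (Unique)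
import Data.List.Relation.Unary.Unique.Propositional.Properties as UniqueP
open UniqueP using (Unique[x∷xs]⇒x∉xs)
open import Data.Nat as ℕ using (ℕ; zero; suc; _≤_; _<_; z≤n; s≤s; _+_; _∸_)
import Data.Nat.DivMod as DivMod
import Data.Nat.Properties as ℕP
open import Data.Nat.Tactic.RingSolver using (solve-∀)
open import Data.Product using (Σ; _×_; _,_; proj₁; proj₂; ∃-syntax)
open import Data.Rational as ℚ using (ℚ; 0ℚ; 1ℚ)
import Data.Rational.Properties as ℚP
import Data.Rational.Solver as ℚSolver
open import Data.Sum using (_⊎_; inj₁; inj₂; swap)
open import Function using (id; _∘_; _∘′_; _⇔_; mk⇔; Equivalence)
import Function.Properties.Equivalence as ⇔
open import Relation.Binary.Definitions using (tri<; tri≈; tri>)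
open import Relation.Binary.PropositionalEquality
  using (_≡_; _≢_; refl; sym; trans; cong; cong₂; subst; subst₂; setoid; module ≡-Reasoning)
open import Relation.Nullary using (¬_; ¬?; Dec; yes; no; contradiction)
open import Relation.Nullary.Decidable using (_×-dec_; _→-dec_)

import Algebra.Properties.CommutativeSemigroup (CommutativeMonoid.commutativeSemigroup ℚP.+-0-commutativeMonoid) as ℚ+
import Algebra.Properties.Group (AbelianGroup.group ℚP.+-0-abelianGroup) as ℚ-Group
import Data.List.Extrema ℕP.≤-totalOrder as ℕExtrema
import Data.List.Extrema ℤP.≤-totalOrder as ℤExtrema

private
  variable
    N k : ℕ
    a b : Fin N
    u v w : Word N

val-injective : val a ≡ val b → a ≡ b
val-injective = FinP.toℕ-injective ∘′ ℕP.suc-injective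

_∈?_ : (a : Fin N) (w : Word N) → Dec (a ∈ w)
a ∈? w = any? (a FinP.≟_) w

unique-resp-↭ : {A : Set} {xs ys : List A} → xs ↭ ys → Unique xs → Unique ys
unique-resp-↭ p = ↭ₛP.Unique-resp-↭ (setoid _) (↭⇒↭ₛ p)

unique-shift : ∀ v₁ {v₂} → Unique (v₁ ++ a ∷ v₂) → Unique (a ∷ v₁ ++ v₂)
unique-shift v₁ = unique-resp-↭ (↭P.shift _ v₁ _)

∈-shift : ∀ v₁ {v₂} {b} → b ∈ v₁ ++ a ∷ v₂ → b ∈ a ∷ v₁ ++ v₂
∈-shift v₁ = ↭P.∈-resp-↭ (↭P.shift _ v₁ _)

∈-unshift : ∀ v₁ {v₂} {b} → b ∈ a ∷ v₁ ++ v₂ → b ∈ v₁ ++ a ∷ v₂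
∈-unshift v₁ = ↭P.∈-resp-↭ (↭.↭-sym (↭P.shift _ v₁ _))

swap-↭ : ∀ (x : Word N) {c y} → x ++ a ∷ c ∷ y ↭ x ++ c ∷ a ∷ y
swap-↭ x = ↭P.++⁺ˡ x (↭.swap _ _ ↭.refl)

repeat⇒¬unique : HasRepeat w → ¬ Unique w
repeat⇒¬unique (a , p , m , s , refl) uw =
  Unique[x∷xs]⇒x∉xs (unique-shift p uw) (∈P.∈-++⁺ʳ p (∈P.∈-++⁺ʳ m (here refl)))

repeat-at-head : a ∈ w → HasRepeat (a ∷ w)
repeat-at-head {a = a} a∈w with ∈P.∈-∃++ a∈w
... | w₁ , w₂ , refl = a , [] , w₁ , w₂ , refl

unique-or-repeat : (w : Word N) → Unique w ⊎ HasRepeat w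
unique-or-repeat [] = inj₁ []
unique-or-repeat (a ∷ w) with a ∈? w | unique-or-repeat w
... | yes a∈w | _ = inj₂ (repeat-at-head a∈w)
... | no a∉w | inj₁ uw = inj₁ (AllP.¬Any⇒All¬ w a∉w ∷ uw)
... | no _   | inj₂ (b , p , m , s , refl) = inj₂ (b , a ∷ p , m , s , refl)

unique? : (w : Word N) → Dec (Unique w)
unique? w with unique-or-repeat w
... | inj₁ uw = yes uw
... | inj₂ r  = no (repeat⇒¬unique r)

unique-map : ∀ {A B : Set} (f : A → B) {xs} → Unique xs →
  (∀ {x y} → x ∈ xs → y ∈ xs → f x ≡ f y → x ≡ y) → Unique (map f xs)
unique-map f {[]}     []        _   = []
unique-map f {x ∷ xs} (x∉ ∷ ux) inj =
  AllP.map⁺ (All.tabulate λ y∈ fx≡fy → All.lookup x∉ y∈ (inj (here refl) (there y∈) fx≡fy)) ∷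
  unique-map f ux (λ x∈ y∈ → inj (there x∈) (there y∈))

unique-↭ : ∀ {A : Set} {xs ys : List A} → Unique xs → Unique ys → xs ⊆ ys → ys ⊆ xs → xs ↭ ys
unique-↭ {xs = xs} {ys} ux uy xs⊆ys ys⊆xs = ∼bag⇒↭ (unique∧set⇒bag {xs = xs} {ys = ys} ux uy (mk⇔ xs⊆ys ys⊆xs))

unique-concatMap : ∀ {A B : Set} (f : A → List B) {xs} → Unique xs → (∀ x → x ∈ xs → Unique (f x)) →
  (∀ {x y} → x ≢ y → Disjoint (f x) (f y)) → Unique (concatMap f xs)
unique-concatMap f ux uf disj =
  UniqueP.concat⁺ (AllP.map⁺ (All.tabulate (uf _))) (AllPairsP.map⁺ (AllPairs.map disj ux))

∈-upTo⁻ : ∀ {j n} → j ∈ upTo n → j < n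
∈-upTo⁻ j∈ with AnyP.applyUpTo⁻ id j∈
... | _ , i<n , refl = i<n

∈-upTo⁺ : ∀ {j n} → j < n → j ∈ upTo n
∈-upTo⁺ = ∈P.∈-applyUpTo⁺ id

data Before {N : ℕ} (a b : Fin N) : Word N → Set where
  now   : ∀ {w} → b ∈ w → Before a b (a ∷ w)
  later : ∀ {c w} → Before a b w → Before a b (c ∷ w)

Before⇒∈ˡ : Before a b w → a ∈ w
Before⇒∈ˡ (now _)   = here refl
Before⇒∈ˡ (later p) = there (Before⇒∈ˡ p)

Before⇒∈ʳ : Before a b w → b ∈ w
Before⇒∈ʳ (now b∈)  = there b∈
Before⇒∈ʳ (later p) = there (Before⇒∈ʳ p)

Before-asym : Unique w → Before a b w → ¬ Before b a w
Before-asym uw        (now b∈)   (now _)    = Unique[x∷xs]⇒x∉xs uw b∈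
Before-asym uw        (now _)    (later ba) = Unique[x∷xs]⇒x∉xs uw (Before⇒∈ʳ ba)
Before-asym uw        (later ab) (now _)    = Unique[x∷xs]⇒x∉xs uw (Before⇒∈ʳ ab)
Before-asym (_ ∷ uw)  (later ab) (later ba) = Before-asym uw ab ba

Before-total : a ∈ w → b ∈ w → a ≢ b → Before a b w ⊎ Before b a w
Before-total (here refl) (here refl) a≢b = contradiction refl a≢b
Before-total (here refl) (there b∈)  _   = inj₁ (now b∈)
Before-total (there a∈)  (here refl) _   = inj₂ (now a∈)
Before-total (there a∈)  (there b∈)  a≢b with Before-total a∈ b∈ a≢b
... | inj₁ ab = inj₁ (later ab)
... | inj₂ ba = inj₂ (later ba)

before? : (a b : Fin N) (w : Word N) → Dec (Before a b w)
before? a b [] = no λ ()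
before? a b (c ∷ w) with before? a b w
... | yes ab = yes (later ab)
... | no ¬ab with a FinP.≟ c | b ∈? w
...   | yes refl | yes b∈ = yes (now b∈)
...   | yes refl | no b∉  = no λ { (now b∈) → b∉ b∈ ; (later ab) → ¬ab ab }
...   | no a≢c   | _      = no λ { (now _) → a≢c refl ; (later ab) → ¬ab ab }

Before-head : Before b a (a ∷ w) → a ∈ w
Before-head (now a∈)   = a∈
Before-head (later ba) = Before⇒∈ʳ ba

Before-tail : ∀ {c} → Before a b (c ∷ w) → a ≡ c ⊎ Before a b w
Before-tail (now _)    = inj₁ refl
Before-tail (later ab) = inj₂ ab

Before-prefix : ∀ v₁ {v₂} → b ∈ v₁ → Before b a (v₁ ++ a ∷ v₂)
Before-prefix (_ ∷ v₁) (here refl) = now (∈P.∈-++⁺ʳ v₁ (here refl))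
Before-prefix (_ ∷ v₁) (there b∈)  = later (Before-prefix v₁ b∈)

Before-insert : ∀ v₁ {v₂ c d} → Before c d (v₁ ++ v₂) → Before c d (v₁ ++ a ∷ v₂)
Before-insert []       cd         = later cd
Before-insert (_ ∷ v₁) (now d∈)   = now (∈-unshift v₁ (there d∈))
Before-insert (_ ∷ v₁) (later cd) = later (Before-insert v₁ cd)

Before-swap : ∀ x {y c d e} → Before d e (x ++ a ∷ c ∷ y) → ¬ (d ≡ a × e ≡ c) →
              Before d e (x ++ c ∷ a ∷ y)
Before-swap []      (now (here refl))      ¬ac = contradiction (refl , refl) ¬ac
Before-swap []      (now (there e∈))       _   = later (now e∈)
Before-swap []      (later (now e∈))       _   = now (there e∈)
Before-swap []      (later (later de))     _   = later (later de)
Before-swap (_ ∷ x) (now e∈)               _   = now (↭P.∈-resp-↭ (swap-↭ x) e∈)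
Before-swap (_ ∷ x) (later de)             ¬ac = later (Before-swap x de ¬ac)

-- k-inversions

Inverts : ℕ → Fin N → Fin N → Set
Inverts k a b = val b < val a × val a < val b + k

inverts? : (k : ℕ) (a b : Fin N) → Dec (Inverts k a b)
inverts? k a b = (val b ℕ.<? val a) ×-dec (val a ℕ.<? val b + k)

inversionsOf : ℕ → Fin N → Word N → ℕ
inversionsOf k a v = length (filter (inverts? k a) v)

inversionsOf-++ : ∀ k (a : Fin N) v w → inversionsOf k a (v ++ w) ≡ inversionsOf k a v + inversionsOf k a w
inversionsOf-++ k a v w = trans (cong length (LP.filter-++ (inverts? k a) v w)) (LP.length-++ (filter (inverts? k a) v))

inversionsOf-swap : ∀ k (a b c : Fin N) x y →
  inversionsOf k a (x ++ b ∷ c ∷ y) ≡ inversionsOf k a (x ++ c ∷ b ∷ y)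
inversionsOf-swap k a b c x y = begin
  I (x ++ b ∷ c ∷ y)                        ≡⟨ inversionsOf-++ k a x _ ⟩
  I x + I (b ∷ c ∷ y)                       ≡⟨ cong (_+_ (I x)) (split b c) ⟩
  I x + (I (b ∷ []) + (I (c ∷ []) + I y))   ≡⟨ cong (_+_ (I x)) (middle (I (b ∷ [])) (I (c ∷ [])) (I y)) ⟩
  I x + (I (c ∷ []) + (I (b ∷ []) + I y))   ≡⟨ cong (_+_ (I x)) (split c b) ⟨
  I x + I (c ∷ b ∷ y)                       ≡⟨ inversionsOf-++ k a x _ ⟨
  I (x ++ c ∷ b ∷ y)                        ∎
  where
  open ≡-Reasoning
  I : Word _ → ℕ
  I = inversionsOf k a
  split : ∀ d e → I (d ∷ e ∷ y) ≡ I (d ∷ []) + (I (e ∷ []) + I y)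
  split d e = trans (inversionsOf-++ k a (d ∷ []) (e ∷ y)) (cong (_+_ (I (d ∷ []))) (inversionsOf-++ k a (e ∷ []) y))
  middle : ∀ p q r → p + (q + r) ≡ q + (p + r)
  middle = solve-∀

inv-swap : ∀ k (a c : Fin N) x y →
  inv k (x ++ a ∷ c ∷ y) + inversionsOf k c (a ∷ []) ≡ inv k (x ++ c ∷ a ∷ y) + inversionsOf k a (c ∷ [])
inv-swap k a c [] y
  rewrite inversionsOf-++ k a (c ∷ []) y | inversionsOf-++ k c (a ∷ []) y =
  rearrange (inversionsOf k a (c ∷ [])) (inversionsOf k a y) (inversionsOf k c y) (inv k y) (inversionsOf k c (a ∷ []))
  where
  rearrange : ∀ p q r s t → (p + q) + (r + s) + t ≡ (t + r) + (q + s) + p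
  rearrange = solve-∀
inv-swap k a c (b ∷ x) y = begin
  (B (x ++ a ∷ c ∷ y) + inv k (x ++ a ∷ c ∷ y)) + inversionsOf k c (a ∷ [])
    ≡⟨ ℕP.+-assoc (B (x ++ a ∷ c ∷ y)) _ _ ⟩
  B (x ++ a ∷ c ∷ y) + (inv k (x ++ a ∷ c ∷ y) + inversionsOf k c (a ∷ []))
    ≡⟨ cong₂ _+_ (inversionsOf-swap k b a c x y) (inv-swap k a c x y) ⟩
  B (x ++ c ∷ a ∷ y) + (inv k (x ++ c ∷ a ∷ y) + inversionsOf k a (c ∷ []))
    ≡⟨ ℕP.+-assoc (B (x ++ c ∷ a ∷ y)) _ _ ⟨
  (B (x ++ c ∷ a ∷ y) + inv k (x ++ c ∷ a ∷ y)) + inversionsOf k a (c ∷ []) ∎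
  where
  open ≡-Reasoning
  B : Word _ → ℕ
  B = inversionsOf k b

inversionsOf-single-yes : Inverts k a b → inversionsOf k a (b ∷ []) ≡ 1
inversionsOf-single-yes {k = k} {a = a} ab rewrite LP.filter-accept (inverts? k a) {xs = []} ab = refl

inversionsOf-single-no : ¬ Inverts k a b → inversionsOf k a (b ∷ []) ≡ 0
inversionsOf-single-no {k = k} {a = a} ¬ab rewrite LP.filter-reject (inverts? k a) {xs = []} ¬ab = refl

inv-swap-far : val a + k < val b → ∀ x y → inv k (x ++ a ∷ b ∷ y) ≡ inv k (x ++ b ∷ a ∷ y)
inv-swap-far {a = a} {k = k} {b = b} far x y = ℕP.+-cancelʳ-≡ 0 _ _ (begin
  inv k (x ++ a ∷ b ∷ y) + 0                          ≡⟨ cong (_+_ _) (inversionsOf-single-no b↛a) ⟨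
  inv k (x ++ a ∷ b ∷ y) + inversionsOf k b (a ∷ [])  ≡⟨ inv-swap k a b x y ⟩
  inv k (x ++ b ∷ a ∷ y) + inversionsOf k a (b ∷ [])  ≡⟨ cong (_+_ _) (inversionsOf-single-no a↛b) ⟩
  inv k (x ++ b ∷ a ∷ y) + 0                          ∎)
  where
  open ≡-Reasoning
  b↛a : ¬ Inverts k b a
  b↛a (_ , b<a+k) = ℕP.<-asym far b<a+k
  a↛b : ¬ Inverts k a b
  a↛b (b<a , _) = ℕP.<-asym (ℕP.≤-<-trans (ℕP.m≤m+n (val a) k) far) b<a

inv-swap-near : val a < val b → val b < val a + k → ∀ x y → suc (inv k (x ++ a ∷ b ∷ y)) ≡ inv k (x ++ b ∷ a ∷ y)
inv-swap-near {a = a} {b = b} {k = k} a<b b<a+k x y = begin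
  suc (inv k (x ++ a ∷ b ∷ y))                        ≡⟨ ℕP.+-comm 1 _ ⟩
  inv k (x ++ a ∷ b ∷ y) + 1                          ≡⟨ cong (_+_ _) (inversionsOf-single-yes (a<b , b<a+k)) ⟨
  inv k (x ++ a ∷ b ∷ y) + inversionsOf k b (a ∷ [])  ≡⟨ inv-swap k a b x y ⟩
  inv k (x ++ b ∷ a ∷ y) + inversionsOf k a (b ∷ [])  ≡⟨ cong (_+_ _) (inversionsOf-single-no a↛b) ⟩
  inv k (x ++ b ∷ a ∷ y) + 0                          ≡⟨ ℕP.+-identityʳ _ ⟩
  inv k (x ++ b ∷ a ∷ y)                              ∎
  where
  open ≡-Reasoning
  a↛b : ¬ Inverts k a b
  a↛b (b<a , _) = ℕP.<-asym a<b b<a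

-- k-rearrangements

KApart : ℕ → Fin N → Fin N → Set
KApart k a b = val a + k ≡ val b ⊎ val b + k ≡ val a

KApart? : ∀ k (a b : Fin N) → Dec (KApart k a b)
KApart? k a b with val a + k ℕ.≟ val b | val b + k ℕ.≟ val a
... | yes p | _     = yes (inj₁ p)
... | no _  | yes q = yes (inj₂ q)
... | no ¬p | no ¬q = no λ { (inj₁ p) → ¬p p ; (inj₂ q) → ¬q q }

KApart-sym : KApart k a b → KApart k b a
KApart-sym (inj₁ p) = inj₂ p
KApart-sym (inj₂ q) = inj₁ q

KApart-far : val a + k < val b → ¬ KApart k a b
KApart-far far (inj₁ p) = ℕP.<-irrefl p far
KApart-far {a = a} {k = k} {b = b} far (inj₂ q) =
  ℕP.<⇒≱ far (ℕP.≤-trans (ℕP.m≤m+n (val b) k) (ℕP.≤-trans (ℕP.≤-reflexive q) (ℕP.m≤m+n (val a) k)))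

KApart-near : val a < val b → val b < val a + k → ¬ KApart k a b
KApart-near _ b<a+k (inj₁ p) = ℕP.<-irrefl (sym p) b<a+k
KApart-near {b = b} {k = k} a<b _ (inj₂ q) = ℕP.<⇒≱ a<b (ℕP.≤-trans (ℕP.m≤m+n (val b) k) (ℕP.≤-reflexive q))

KOrderPreserved : ℕ → Word N → Word N → Set
KOrderPreserved k w u = ∀ a b → KApart k a b → Before a b w → Before a b u

KRearrangement : ℕ → Word N → Word N → Set
KRearrangement k w u = Unique u × u ⊆ w × w ⊆ u × KOrderPreserved k w u

KRearrangement? : ∀ k (w u : Word N) → Dec (KRearrangement k w u)
KRearrangement? k w u =
  unique? u ×-dec SubsetDec._⊆?_ FinP._≟_ u w ×-dec SubsetDec._⊆?_ FinP._≟_ w u ×-dec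
  FinP.all? (λ a → FinP.all? (λ b → KApart? k a b →-dec before? a b w →-dec before? a b u))

KRearrangement-refl : Unique w → KRearrangement k w w
KRearrangement-refl uw = uw , (λ x → x) , (λ x → x) , λ _ _ _ ab → ab

KRearrangement-sym : Unique w → KRearrangement k w u → KRearrangement k u w
KRearrangement-sym {w = w} {k = k} {u = u} uw (uu , u⊆w , w⊆u , ord) = uw , w⊆u , u⊆w , ord′
  where
  ord′ : KOrderPreserved k u w
  ord′ a b apart ab with Before-total (u⊆w (Before⇒∈ˡ ab)) (u⊆w (Before⇒∈ʳ ab)) (λ { refl → Before-asym uu ab ab })
  ... | inj₁ ab′ = ab′
  ... | inj₂ ba  = contradiction (ord b a (KApart-sym apart) ba) (Before-asym uu ab)

KRearrangement-swap : ∀ {c} x {y} → ¬ KApart k a c →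
  KRearrangement k w (x ++ a ∷ c ∷ y) → KRearrangement k w (x ++ c ∷ a ∷ y)
KRearrangement-swap x ¬apart (uu , u⊆w , w⊆u , ord) =
  unique-resp-↭ (swap-↭ x) uu ,
  u⊆w ∘ ↭P.∈-resp-↭ (↭.↭-sym (swap-↭ x)) ,
  ↭P.∈-resp-↭ (swap-↭ x) ∘ w⊆u ,
  λ d e apart de → Before-swap x (ord d e apart de) λ { (refl , refl) → ¬apart apart }

-- A letter in front of a in the source and k apart from it would precede a in the target, where a comes first.
KRearrangement-peel : ∀ v₁ {v₂ w} → Unique (v₁ ++ a ∷ v₂) → KRearrangement k (v₁ ++ a ∷ v₂) (a ∷ w) →
  All (λ b → b ≢ a × ¬ KApart k b a) v₁ × Unique (v₁ ++ v₂) × KRearrangement k (v₁ ++ v₂) w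
KRearrangement-peel {a = a} {k = k} v₁ {v₂} {w} uv (a∉w ∷ uw , w⊆v , v⊆w , ord) =
  All.tabulate (λ b∈ → b≢a b∈ , ¬apart b∈) , uv′ , uw , w⊆v′ , v⊆w′ , ord′
  where
  a∉v : a ∉ v₁ ++ v₂
  a∉v = Unique[x∷xs]⇒x∉xs (unique-shift v₁ uv)
  uv′ : Unique (v₁ ++ v₂)
  uv′ with unique-shift v₁ uv
  ... | _ ∷ u = u
  a∉w′ : a ∉ w
  a∉w′ = AllP.All¬⇒¬Any a∉w
  b≢a : ∀ {b} → b ∈ v₁ → b ≢ a
  b≢a b∈ refl = a∉v (∈P.∈-++⁺ˡ b∈)
  ¬apart : ∀ {b} → b ∈ v₁ → ¬ KApart k b a
  ¬apart b∈ apart = a∉w′ (Before-head (ord _ a apart (Before-prefix v₁ b∈)))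
  w⊆v′ : w ⊆ v₁ ++ v₂
  w⊆v′ x∈ with ∈-shift v₁ (w⊆v (there x∈))
  ... | here refl = contradiction x∈ a∉w′
  ... | there x∈′ = x∈′
  v⊆w′ : v₁ ++ v₂ ⊆ w
  v⊆w′ x∈ with v⊆w (∈-unshift v₁ (there x∈))
  ... | here refl = contradiction x∈ a∉v
  ... | there x∈′ = x∈′
  ord′ : KOrderPreserved k (v₁ ++ v₂) w
  ord′ c d apart cd with Before-tail (ord c d apart (Before-insert v₁ cd))
  ... | inj₁ refl = contradiction (Before⇒∈ˡ cd) a∉v
  ... | inj₂ cd′ = cd′

termCoeff : Term N → ℤ → Word N → ℚ
termCoeff (c , e′ , w′) e w with e′ ℤ.≟ e | LP.≡-dec Fin._≟_ w′ w
... | yes _ | yes _ = c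
... | _     | _     = 0ℚ

coeff-∷ : ∀ (t : Term N) xs e w → coeff (t ∷ xs) e w ≡ termCoeff t e w ℚ.+ coeff xs e w
coeff-∷ (c , e′ , w′) xs e w with e′ ℤ.≟ e | LP.≡-dec Fin._≟_ w′ w
... | yes _ | yes _ = refl
... | yes _ | no _  = sym (ℚP.+-identityˡ _)
... | no _  | _     = sym (ℚP.+-identityˡ _)

coeff-++ : ∀ (xs ys : LinComb N) e w → coeff (xs ++ ys) e w ≡ coeff xs e w ℚ.+ coeff ys e w
coeff-++ []       ys e w = sym (ℚP.+-identityˡ _)
coeff-++ (t ∷ xs) ys e w = begin
  coeff (t ∷ xs ++ ys) e w                          ≡⟨ coeff-∷ t (xs ++ ys) e w ⟩
  termCoeff t e w ℚ.+ coeff (xs ++ ys) e w          ≡⟨ cong (termCoeff t e w ℚ.+_) (coeff-++ xs ys e w) ⟩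
  termCoeff t e w ℚ.+ (coeff xs e w ℚ.+ coeff ys e w) ≡⟨ ℚP.+-assoc (termCoeff t e w) _ _ ⟨
  (termCoeff t e w ℚ.+ coeff xs e w) ℚ.+ coeff ys e w ≡⟨ cong (ℚ._+ coeff ys e w) (coeff-∷ t xs e w) ⟨
  coeff (t ∷ xs) e w ℚ.+ coeff ys e w               ∎
  where open ≡-Reasoning

negateTerm : Term N → Term N
negateTerm (c , e , w) = ℚ.- c , e , w

termCoeff-negate : ∀ (t : Term N) e w → termCoeff (negateTerm t) e w ≡ ℚ.- termCoeff t e w
termCoeff-negate (c , e′ , w′) e w with e′ ℤ.≟ e | LP.≡-dec Fin._≟_ w′ w
... | yes _ | yes _ = refl
... | yes _ | no _  = refl
... | no _  | _     = refl

coeff-negate : ∀ (xs : LinComb N) e w → coeff (map negateTerm xs) e w ≡ ℚ.- coeff xs e w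
coeff-negate []       e w = refl
coeff-negate (t ∷ xs) e w = begin
  coeff (negateTerm t ∷ map negateTerm xs) e w               ≡⟨ coeff-∷ (negateTerm t) _ e w ⟩
  termCoeff (negateTerm t) e w ℚ.+ coeff (map negateTerm xs) e w ≡⟨ cong₂ ℚ._+_ (termCoeff-negate t e w) (coeff-negate xs e w) ⟩
  ℚ.- termCoeff t e w ℚ.+ ℚ.- coeff xs e w                  ≡⟨ ℚP.neg-distrib-+ (termCoeff t e w) _ ⟨
  ℚ.- (termCoeff t e w ℚ.+ coeff xs e w)                    ≡⟨ cong ℚ.-_ (coeff-∷ t xs e w) ⟨
  ℚ.- coeff (t ∷ xs) e w                                    ∎
  where open ≡-Reasoning

-- Congruence modulo the ideal

Monomial : ℕ → Set
Monomial N = ℤ × Word N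

infix 25 _⊟_
_⊟_ : Monomial N → Monomial N → LinComb N
(e , u) ⊟ (e′ , v) = (1ℚ , e , u) ∷ (ℚ.- 1ℚ , e′ , v) ∷ []

monoCoeff : Monomial N → ℤ → Word N → ℚ
monoCoeff m = termCoeff (1ℚ , m)

coeff-⊟ : ∀ (m m′ : Monomial N) e w → coeff (m ⊟ m′) e w ≡ monoCoeff m e w ℚ.- monoCoeff m′ e w
coeff-⊟ m m′ e w
  rewrite coeff-∷ (1ℚ , m) ((ℚ.- 1ℚ , m′) ∷ []) e w | coeff-∷ (ℚ.- 1ℚ , m′) [] e w
        | termCoeff-negate (1ℚ , m′) e w = cong (termCoeff (1ℚ , m) e w ℚ.+_) (ℚP.+-identityʳ _)

record Congruent (k : ℕ) (m m′ : Monomial N) : Set where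
  constructor _by_
  field
    instances : List (GenInst N k)
    expansion : concatMap expand instances ≋ m ⊟ m′

Congruent-refl : (m : Monomial N) → Congruent k m m
Congruent-refl m = [] by λ e w → sym (trans (coeff-⊟ m m e w) (ℚP.+-inverseʳ (monoCoeff m e w)))

Congruent-trans : {m₁ m₂ m₃ : Monomial N} → Congruent k m₁ m₂ → Congruent k m₂ m₃ → Congruent k m₁ m₃
Congruent-trans {m₁ = m₁} {m₂} {m₃} (gs by p) (hs by q) = (gs ++ hs) by λ e w → begin
  coeff (concatMap expand (gs ++ hs)) e w
    ≡⟨ cong (λ L → coeff L e w) (LP.concatMap-++ expand gs hs) ⟩
  coeff (concatMap expand gs ++ concatMap expand hs) e w
    ≡⟨ coeff-++ (concatMap expand gs) _ e w ⟩
  coeff (concatMap expand gs) e w ℚ.+ coeff (concatMap expand hs) e w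
    ≡⟨ cong₂ ℚ._+_ (trans (p e w) (coeff-⊟ m₁ m₂ e w)) (trans (q e w) (coeff-⊟ m₂ m₃ e w)) ⟩
  (monoCoeff m₁ e w ℚ.- monoCoeff m₂ e w) ℚ.+ (monoCoeff m₂ e w ℚ.- monoCoeff m₃ e w)
    ≡⟨ telescope (monoCoeff m₁ e w) (monoCoeff m₂ e w) (monoCoeff m₃ e w) ⟩
  monoCoeff m₁ e w ℚ.- monoCoeff m₃ e w
    ≡⟨ coeff-⊟ m₁ m₃ e w ⟨
  coeff (m₁ ⊟ m₃) e w ∎
  where
  open ≡-Reasoning
  telescope : ∀ A B C → (A ℚ.- B) ℚ.+ (B ℚ.- C) ≡ A ℚ.- C
  telescope = solve 3 (λ A B C → (A :- B) :+ (B :- C) := A :- C) refl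
    where open ℚSolver.+-*-Solver

negateInstance : GenInst N k → GenInst N k
negateInstance g = record g { coef = ℚ.- GenInst.coef g }

expand-negate : (g : GenInst N k) → expand (negateInstance g) ≡ map negateTerm (expand g)
expand-negate g = trans
  (LP.map-cong (λ { (c , e , w) → cong (λ d → d , _) (sym (ℚP.neg-distribˡ-* (GenInst.coef g) c)) }) (GenInst.gen g))
  (LP.map-∘ (GenInst.gen g))

concatMap-negate : (gs : List (GenInst N k)) →
  concatMap expand (map negateInstance gs) ≡ map negateTerm (concatMap expand gs)
concatMap-negate [] = refl
concatMap-negate (g ∷ gs) = trans (cong₂ _++_ (expand-negate g) (concatMap-negate gs))
                                  (sym (LP.map-++ negateTerm (expand g) (concatMap expand gs)))

Congruent-sym : {m m′ : Monomial N} → Congruent k m m′ → Congruent k m′ m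
Congruent-sym {m = m} {m′} (gs by p) = map negateInstance gs by λ e w → begin
  coeff (concatMap expand (map negateInstance gs)) e w ≡⟨ cong (λ L → coeff L e w) (concatMap-negate gs) ⟩
  coeff (map negateTerm (concatMap expand gs)) e w     ≡⟨ coeff-negate (concatMap expand gs) e w ⟩
  ℚ.- coeff (concatMap expand gs) e w                  ≡⟨ cong ℚ.-_ (trans (p e w) (coeff-⊟ m m′ e w)) ⟩
  ℚ.- (monoCoeff m e w ℚ.- monoCoeff m′ e w)           ≡⟨ flip (monoCoeff m e w) (monoCoeff m′ e w) ⟩
  monoCoeff m′ e w ℚ.- monoCoeff m e w                 ≡⟨ coeff-⊟ m′ m e w ⟨
  coeff (m′ ⊟ m) e w                                   ∎
  where
  open ≡-Reasoning
  flip : ∀ A B → ℚ.- (A ℚ.- B) ≡ B ℚ.- A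
  flip = solve 2 (λ A B → :- (A :- B) := B :- A) refl
    where open ℚSolver.+-*-Solver

by-single : {m m′ : Monomial N} (g : GenInst N k) → concatMap expand (g ∷ []) ≡ m ⊟ m′ → Congruent k m m′
by-single g eq = (g ∷ []) by λ e w → cong (λ L → coeff L e w) eq

instanceAt : ℤ → Word N → Word N → {f : LinComb N} → Gen N k f → GenInst N k
instanceAt e x y g = record { coef = 1ℚ ; expo = e ; left = x ; gen = _ ; isGen = g ; right = y }

comm-congruent : ∀ {c} → val a + k < val c → ∀ e x y → Congruent k (e , x ++ a ∷ c ∷ y) (e , x ++ c ∷ a ∷ y)
comm-congruent {a = a} {c = c} a+k<c e x y = by-single (instanceAt e x y (comm a c a+k<c))
  (cong (λ d → (1ℚ , d , x ++ a ∷ c ∷ y) ∷ (ℚ.- 1ℚ , d , x ++ c ∷ a ∷ y) ∷ []) (ℤP.+-identityʳ e))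

qcomm-congruent : val a < val b → val b < val a + k → ∀ e x y →
  Congruent k (e , x ++ a ∷ b ∷ y) (e ℤ.+ -[1+ 0 ] , x ++ b ∷ a ∷ y)
qcomm-congruent {a = a} {b = b} a<b b<a+k e x y = by-single (instanceAt e x y (qcomm a b a<b b<a+k))
  (cong (λ d → (1ℚ , d , x ++ a ∷ b ∷ y) ∷ (ℚ.- 1ℚ , e ℤ.+ -[1+ 0 ] , x ++ b ∷ a ∷ y) ∷ []) (ℤP.+-identityʳ e))

Congruent-exponents : ∀ {e₁ e₁′ e₂ e₂′} → e₁ ≡ e₁′ → e₂ ≡ e₂′ →
  Congruent k (e₁ , u) (e₂ , v) → Congruent k (e₁′ , u) (e₂′ , v)
Congruent-exponents refl refl p = p

Balanced : ℕ → ℤ → Word N → Word N → Set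
Balanced k E u v = Congruent k (E ℤ.- + inv k u , u) (E ℤ.- + inv k v , v)

swap-balanced-< : ∀ {c} → val a < val c → ¬ KApart k a c → ∀ E x y →
  Balanced k E (x ++ a ∷ c ∷ y) (x ++ c ∷ a ∷ y)
swap-balanced-< {a = a} {k = k} {c = c} a<c ¬apart E x y with ℕP.<-cmp (val a + k) (val c)
... | tri< far _ _ = Congruent-exponents refl (cong (λ n → E ℤ.- + n) (inv-swap-far far x y))
                       (comm-congruent far (E ℤ.- + inv k (x ++ a ∷ c ∷ y)) x y)
... | tri≈ _ p _   = contradiction (inj₁ p) ¬apart
... | tri> _ _ near = Congruent-exponents refl exponent
                       (qcomm-congruent a<c near (E ℤ.- + inv k (x ++ a ∷ c ∷ y)) x y)
  where
  shift : ∀ (E X : ℤ) → E ℤ.- X ℤ.+ -[1+ 0 ] ≡ E ℤ.- (+ 1 ℤ.+ X)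
  shift = ℤSolver.solve-∀
  exponent : E ℤ.- + inv k (x ++ a ∷ c ∷ y) ℤ.+ -[1+ 0 ] ≡ E ℤ.- + inv k (x ++ c ∷ a ∷ y)
  exponent = trans (shift E _) (cong (λ n → E ℤ.- + n) (inv-swap-near a<c near x y))

swap-balanced : ∀ {c} → a ≢ c → ¬ KApart k a c → ∀ E x y → Balanced k E (x ++ a ∷ c ∷ y) (x ++ c ∷ a ∷ y)
swap-balanced {a = a} {c = c} a≢c ¬apart E x y with ℕP.<-cmp (val a) (val c)
... | tri< a<c _ _ = swap-balanced-< a<c ¬apart E x y
... | tri≈ _ p _   = contradiction (val-injective p) a≢c
... | tri> _ _ c<a = Congruent-sym (swap-balanced-< c<a (¬apart ∘ KApart-sym) E x y)

move-to-front : ∀ E p v₁ {v₂} → All (λ b → b ≢ a × ¬ KApart k b a) v₁ →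
  Balanced k E (p ++ v₁ ++ a ∷ v₂) (p ++ a ∷ v₁ ++ v₂)
move-to-front E p [] [] = Congruent-refl _
move-to-front {a = a} {k = k} E p (b ∷ v₁) {v₂} ((b≢a , ¬apart) ∷ rest) = Congruent-trans
  (subst₂ (Balanced k E) (LP.++-assoc p (b ∷ []) (v₁ ++ a ∷ v₂)) (LP.++-assoc p (b ∷ []) (a ∷ v₁ ++ v₂))
    (move-to-front E (p ++ b ∷ []) v₁ rest))
  (swap-balanced b≢a ¬apart E p (v₁ ++ v₂))

KRearrangement-balanced : Unique v → KRearrangement k v w → ∀ E p → Balanced k E (p ++ v) (p ++ w)
KRearrangement-balanced {v = []}    {w = []}    _ _ E p = Congruent-refl _
KRearrangement-balanced {v = _ ∷ _} {w = []}    _ (_ , _ , v⊆w , _) E p with v⊆w (here refl)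
... | ()
KRearrangement-balanced {v = v} {k = k} {w = a ∷ w} uv r E p with ∈P.∈-∃++ (proj₁ (proj₂ r) (here refl))
... | v₁ , v₂ , refl with KRearrangement-peel v₁ uv r
...   | movable , uv′ , r′ = Congruent-trans (move-to-front E p v₁ movable)
  (subst₂ (Balanced k E) (LP.++-assoc p (a ∷ []) (v₁ ++ v₂)) (LP.++-assoc p (a ∷ []) w)
    (KRearrangement-balanced uv′ r′ E (p ++ a ∷ [])))

evaluate : (ℤ → Word N → ℚ) → LinComb N → ℚ
evaluate K []                 = 0ℚ
evaluate K ((c , e , w) ∷ xs) = c ℚ.* K e w ℚ.+ evaluate K xs

evaluate-++ : ∀ (K : ℤ → Word N → ℚ) xs ys → evaluate K (xs ++ ys) ≡ evaluate K xs ℚ.+ evaluate K ys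
evaluate-++ K []                 ys = sym (ℚP.+-identityˡ _)
evaluate-++ K ((c , e , w) ∷ xs) ys =
  trans (cong (c ℚ.* K e w ℚ.+_) (evaluate-++ K xs ys)) (sym (ℚP.+-assoc (c ℚ.* K e w) _ _))

evaluate-negate : ∀ (K : ℤ → Word N → ℚ) xs → evaluate K (map negateTerm xs) ≡ ℚ.- evaluate K xs
evaluate-negate K []                 = refl
evaluate-negate K ((c , e , w) ∷ xs) =
  trans (cong₂ ℚ._+_ (sym (ℚP.neg-distribˡ-* c (K e w))) (evaluate-negate K xs))
        (sym (ℚP.neg-distrib-+ (c ℚ.* K e w) (evaluate K xs)))

remove : ℤ → Word N → LinComb N → LinComb N
remove e w [] = []
remove e w ((c , e′ , w′) ∷ xs) with e′ ℤ.≟ e | LP.≡-dec Fin._≟_ w′ w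
... | yes _ | yes _ = remove e w xs
... | _     | _     = (c , e′ , w′) ∷ remove e w xs

length-remove : ∀ e w (xs : LinComb N) → length (remove e w xs) ≤ length xs
length-remove e w [] = z≤n
length-remove e w ((c , e′ , w′) ∷ xs) with e′ ℤ.≟ e | LP.≡-dec Fin._≟_ w′ w
... | yes _ | yes _ = ℕP.m≤n⇒m≤1+n (length-remove e w xs)
... | yes _ | no _  = s≤s (length-remove e w xs)
... | no _  | _     = s≤s (length-remove e w xs)

evaluate-remove : ∀ (K : ℤ → Word N → ℚ) xs e w →
  evaluate K xs ≡ coeff xs e w ℚ.* K e w ℚ.+ evaluate K (remove e w xs)
evaluate-remove K [] e w = sym (trans (ℚP.+-identityʳ _) (ℚP.*-zeroˡ (K e w)))
evaluate-remove K ((c , e′ , w′) ∷ xs) e w with e′ ℤ.≟ e | LP.≡-dec Fin._≟_ w′ w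
... | yes refl | yes refl = trans (cong (c ℚ.* K e w ℚ.+_) (evaluate-remove K xs e w))
                                  (collect c (coeff xs e w) (K e w) _)
  where
  collect : ∀ c C k S → c ℚ.* k ℚ.+ (C ℚ.* k ℚ.+ S) ≡ (c ℚ.+ C) ℚ.* k ℚ.+ S
  collect = solve 4 (λ c C k S → c :* k :+ (C :* k :+ S) := (c :+ C) :* k :+ S) refl
    where open ℚSolver.+-*-Solver
... | yes _ | no _ = trans (cong (c ℚ.* K e′ w′ ℚ.+_) (evaluate-remove K xs e w))
                           (ℚ+.x∙yz≈y∙xz (c ℚ.* K e′ w′) (coeff xs e w ℚ.* K e w) (evaluate K (remove e w xs)))
... | no _  | _    = trans (cong (c ℚ.* K e′ w′ ℚ.+_) (evaluate-remove K xs e w))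
                           (ℚ+.x∙yz≈y∙xz (c ℚ.* K e′ w′) (coeff xs e w ℚ.* K e w) (evaluate K (remove e w xs)))

termCoeff-other : ∀ c e′ (w′ : Word N) e w → ¬ (e′ ≡ e × w′ ≡ w) → termCoeff (c , e′ , w′) e w ≡ 0ℚ
termCoeff-other c e′ w′ e w ne with e′ ℤ.≟ e | LP.≡-dec Fin._≟_ w′ w
... | yes p | yes q = contradiction (p , q) ne
... | yes _ | no _  = refl
... | no _  | _     = refl

remove-head : ∀ c e (w : Word N) xs → remove e w ((c , e , w) ∷ xs) ≡ remove e w xs
remove-head c e w xs with e ℤ.≟ e | LP.≡-dec Fin._≟_ w w
... | yes _ | yes _ = refl
... | no ¬p | _     = contradiction refl ¬p
... | yes _ | no ¬q = contradiction refl ¬q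

coeff-remove-same : ∀ (xs : LinComb N) e w → coeff (remove e w xs) e w ≡ 0ℚ
coeff-remove-same [] e w = refl
coeff-remove-same ((c , e′ , w′) ∷ xs) e w with e′ ℤ.≟ e | LP.≡-dec Fin._≟_ w′ w
... | yes _ | yes _ = coeff-remove-same xs e w
... | yes _ | no ¬q = trans (coeff-∷ (c , e′ , w′) _ e w)
                            (cong₂ ℚ._+_ (termCoeff-other c e′ w′ e w (¬q ∘ proj₂)) (coeff-remove-same xs e w))
... | no ¬p | _     = trans (coeff-∷ (c , e′ , w′) _ e w)
                            (cong₂ ℚ._+_ (termCoeff-other c e′ w′ e w (¬p ∘ proj₁)) (coeff-remove-same xs e w))

coeff-remove-other : ∀ (xs : LinComb N) e w e₂ w₂ → ¬ (e₂ ≡ e × w₂ ≡ w) →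
  coeff (remove e w xs) e₂ w₂ ≡ coeff xs e₂ w₂
coeff-remove-other [] e w e₂ w₂ ne = refl
coeff-remove-other ((c , e′ , w′) ∷ xs) e w e₂ w₂ ne with e′ ℤ.≟ e | LP.≡-dec Fin._≟_ w′ w
... | yes refl | yes refl = begin
  coeff (remove e′ w′ xs) e₂ w₂                       ≡⟨ coeff-remove-other xs e′ w′ e₂ w₂ ne ⟩
  coeff xs e₂ w₂                                      ≡⟨ ℚP.+-identityˡ _ ⟨
  0ℚ ℚ.+ coeff xs e₂ w₂
    ≡⟨ cong (ℚ._+ coeff xs e₂ w₂) (termCoeff-other c e′ w′ e₂ w₂ λ (p , q) → ne (sym p , sym q)) ⟨
  termCoeff (c , e′ , w′) e₂ w₂ ℚ.+ coeff xs e₂ w₂    ≡⟨ coeff-∷ (c , e′ , w′) xs e₂ w₂ ⟨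
  coeff ((c , e′ , w′) ∷ xs) e₂ w₂                    ∎
  where open ≡-Reasoning
... | yes _ | no _ = trans (coeff-∷ (c , e′ , w′) (remove e w xs) e₂ w₂)
  (trans (cong (termCoeff (c , e′ , w′) e₂ w₂ ℚ.+_) (coeff-remove-other xs e w e₂ w₂ ne)) (sym (coeff-∷ (c , e′ , w′) xs e₂ w₂)))
... | no _ | _ = trans (coeff-∷ (c , e′ , w′) (remove e w xs) e₂ w₂)
  (trans (cong (termCoeff (c , e′ , w′) e₂ w₂ ℚ.+_) (coeff-remove-other xs e w e₂ w₂ ne)) (sym (coeff-∷ (c , e′ , w′) xs e₂ w₂)))

-- Strong induction on the length: the terms at the head's monomial may be scattered, so all are removed at once.
evaluate-zero : ∀ (K : ℤ → Word N → ℚ) xs → (∀ e w → coeff xs e w ≡ 0ℚ) → evaluate K xs ≡ 0ℚ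
evaluate-zero K xs = go (length xs) xs ℕP.≤-refl
  where
  go : ∀ n xs → length xs ≤ n → (∀ e w → coeff xs e w ≡ 0ℚ) → evaluate K xs ≡ 0ℚ
  go _       []                 _         _     = refl
  go (suc n) ((c , e , w) ∷ xs) (s≤s len) zeros = begin
    evaluate K ((c , e , w) ∷ xs)
      ≡⟨ evaluate-remove K ((c , e , w) ∷ xs) e w ⟩
    coeff ((c , e , w) ∷ xs) e w ℚ.* K e w ℚ.+ evaluate K (remove e w ((c , e , w) ∷ xs))
      ≡⟨ cong₂ (λ C S → C ℚ.* K e w ℚ.+ S) (zeros e w) (trans (cong (evaluate K) (remove-head c e w xs)) rest) ⟩
    0ℚ ℚ.* K e w ℚ.+ 0ℚ
      ≡⟨ trans (ℚP.+-identityʳ _) (ℚP.*-zeroˡ (K e w)) ⟩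
    0ℚ ∎
    where
    open ≡-Reasoning
    zeros′ : ∀ e₂ w₂ → coeff (remove e w xs) e₂ w₂ ≡ 0ℚ
    zeros′ e₂ w₂ with e₂ ℤ.≟ e | LP.≡-dec Fin._≟_ w₂ w
    ... | yes refl | yes refl = coeff-remove-same xs e w
    ... | yes _    | no ¬q    = trans (cong (λ L → coeff L e₂ w₂) (sym (remove-head c e w xs)))
                                 (trans (coeff-remove-other ((c , e , w) ∷ xs) e w e₂ w₂ (¬q ∘ proj₂)) (zeros e₂ w₂))
    ... | no ¬p    | _        = trans (cong (λ L → coeff L e₂ w₂) (sym (remove-head c e w xs)))
                                 (trans (coeff-remove-other ((c , e , w) ∷ xs) e w e₂ w₂ (¬p ∘ proj₁)) (zeros e₂ w₂))
    rest : evaluate K (remove e w xs) ≡ 0ℚ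
    rest = go n (remove e w xs) (ℕP.≤-trans (length-remove e w xs) len) zeros′

evaluate-resp-≋ : ∀ (K : ℤ → Word N → ℚ) xs ys → xs ≋ ys → evaluate K xs ≡ evaluate K ys
evaluate-resp-≋ K xs ys xs≋ys = ℚ-Group.x∙y⁻¹≈ε⇒x≈y (evaluate K xs) (evaluate K ys) (begin
  evaluate K xs ℚ.- evaluate K ys                         ≡⟨ cong (evaluate K xs ℚ.+_) (evaluate-negate K ys) ⟨
  evaluate K xs ℚ.+ evaluate K (map negateTerm ys)        ≡⟨ evaluate-++ K xs (map negateTerm ys) ⟨
  evaluate K (xs ++ map negateTerm ys)                    ≡⟨ evaluate-zero K (xs ++ map negateTerm ys) zeros ⟩
  0ℚ                                                      ∎)
  where
  open ≡-Reasoning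
  zeros : ∀ e w → coeff (xs ++ map negateTerm ys) e w ≡ 0ℚ
  zeros e w = trans (coeff-++ xs (map negateTerm ys) e w)
                    (trans (cong₂ ℚ._+_ (xs≋ys e w) (coeff-negate ys e w)) (ℚP.+-inverseʳ (coeff ys e w)))

weightedSum : LPoly → (ℤ → ℚ) → ℚ
weightedSum []            F = 0ℚ
weightedSum ((d , e) ∷ D) F = d ℚ.* F e ℚ.+ weightedSum D F

weightedSum-cong : ∀ D {F G : ℤ → ℚ} → (∀ x → F x ≡ G x) → weightedSum D F ≡ weightedSum D G
weightedSum-cong []            F≗G = refl
weightedSum-cong ((d , e) ∷ D) F≗G = cong₂ ℚ._+_ (cong (d ℚ.*_) (F≗G e)) (weightedSum-cong D F≗G)

weightedSum-zero : ∀ D (F : ℤ → ℚ) → (∀ x → F x ≡ 0ℚ) → weightedSum D F ≡ 0ℚ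
weightedSum-zero []            F F≗0 = refl
weightedSum-zero ((d , e) ∷ D) F F≗0 =
  trans (cong₂ ℚ._+_ (trans (cong (d ℚ.*_) (F≗0 e)) (ℚP.*-zeroʳ d)) (weightedSum-zero D F F≗0)) (ℚP.+-identityʳ 0ℚ)

weightedSum-- : ∀ D (F G : ℤ → ℚ) → weightedSum D (λ x → F x ℚ.- G x) ≡ weightedSum D F ℚ.- weightedSum D G
weightedSum-- []            F G = refl
weightedSum-- ((d , e) ∷ D) F G =
  trans (cong (d ℚ.* (F e ℚ.- G e) ℚ.+_) (weightedSum-- D F G)) (distribute d (F e) (G e) (weightedSum D F) (weightedSum D G))
  where
  distribute : ∀ d a b A B → d ℚ.* (a ℚ.- b) ℚ.+ (A ℚ.- B) ≡ d ℚ.* a ℚ.+ A ℚ.- (d ℚ.* b ℚ.+ B)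
  distribute = solve 5 (λ d a b A B → d :* (a :- b) :+ (A :- B) := d :* a :+ A :- (d :* b :+ B)) refl
    where open ℚSolver.+-*-Solver

weightedSum-point : ∀ D (F : ℤ → ℚ) y → (∀ x → x ≡ y → F x ≡ 1ℚ) → (∀ x → x ≢ y → F x ≡ 0ℚ) →
  weightedSum D F ≡ pcoeff D y
weightedSum-point []            F y F≡1 F≡0 = refl
weightedSum-point ((d , e) ∷ D) F y F≡1 F≡0 with e ℤ.≟ y
... | yes e≡y = cong₂ ℚ._+_ (trans (cong (d ℚ.*_) (F≡1 e e≡y)) (ℚP.*-identityʳ d)) (weightedSum-point D F y F≡1 F≡0)
... | no e≢y  = trans (cong₂ ℚ._+_ (trans (cong (d ℚ.*_) (F≡0 e e≢y)) (ℚP.*-zeroʳ d)) (weightedSum-point D F y F≡1 F≡0))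
                      (ℚP.+-identityˡ _)

pcoeff≢0⇒∈ : ∀ D y → pcoeff D y ≢ 0ℚ → y ∈ map proj₂ D
pcoeff≢0⇒∈ []            y nz = contradiction refl nz
pcoeff≢0⇒∈ ((d , e) ∷ D) y nz with e ℤ.≟ y
... | yes e≡y = here (sym e≡y)
... | no _    = there (pcoeff≢0⇒∈ D y nz)

module _ (D : LPoly) where

  private
    NonzeroAt : ℤ → Set
    NonzeroAt y = pcoeff D y ≢ 0ℚ

    nonzeroAt? : ∀ y → Dec (NonzeroAt y)
    nonzeroAt? y = ¬? (pcoeff D y ℚ.≟ 0ℚ)

  topExponent : ℤ → ℤ
  topExponent y₀ = ℤExtrema.max y₀ (filter nonzeroAt? (map proj₂ D))

  topExponent-nonzero : ∀ {y₀} → pcoeff D y₀ ≢ 0ℚ → pcoeff D (topExponent y₀) ≢ 0ℚ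
  topExponent-nonzero nz = ℤExtrema.argmax-all id {P = NonzeroAt} nz (AllP.all-filter nonzeroAt? (map proj₂ D))

  topExponent-maximal : ∀ y₀ {y} → pcoeff D y ≢ 0ℚ → y ℤ.≤ topExponent y₀
  topExponent-maximal y₀ {y} nz =
    All.lookup (ℤExtrema.xs≤max y₀ _) (∈P.∈-filter⁺ nonzeroAt? (pcoeff≢0⇒∈ D y nz) nz)

nonzero-not-periodic : ∀ D → NonzeroLP D → ∀ s → 0 < s → ¬ (∀ y → pcoeff D (y ℤ.+ + s) ≡ pcoeff D y)
nonzero-not-periodic D (y₀ , nz) s 0<s periodic = ℤP.<⇒≱ t<t+s (topExponent-maximal D y₀ nz′)
  where
  t : ℤ
  t = topExponent D y₀
  nz′ : pcoeff D (t ℤ.+ + s) ≢ 0ℚ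
  nz′ eq = topExponent-nonzero D nz (trans (sym (periodic t)) eq)
  t<t+s : t ℤ.< t ℤ.+ + s
  t<t+s = subst (ℤ._< t ℤ.+ + s) (ℤP.+-identityʳ t) (ℤP.+-monoʳ-< t (ℤ.+<+ 0<s))

shifted-period : ∀ {i j} (F : ℤ → ℚ) → i ≤ j → (∀ x → F (x ℤ.- + i) ≡ F (x ℤ.- + j)) →
  ∀ y → F (y ℤ.+ + (j ∸ i)) ≡ F y
shifted-period {i} {j} F i≤j h y = begin
  F (y ℤ.+ + (j ∸ i))          ≡⟨ cong F (trans (cong (ℤ._+_ y) j-i) (regroup y (+ j) (+ i))) ⟩
  F (y ℤ.+ + j ℤ.- + i)        ≡⟨ h (y ℤ.+ + j) ⟩
  F (y ℤ.+ + j ℤ.- + j)        ≡⟨ cong F (cancel y (+ j)) ⟩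
  F y                          ∎
  where
  open ≡-Reasoning
  j-i : + (j ∸ i) ≡ + j ℤ.- + i
  j-i = trans (sym (ℤP.⊖-≥ i≤j)) (sym (ℤP.m-n≡m⊖n j i))
  regroup : ∀ y J I → y ℤ.+ (J ℤ.- I) ≡ y ℤ.+ J ℤ.- I
  regroup = ℤSolver.solve-∀
  cancel : ∀ y J → y ℤ.+ J ℤ.- J ≡ y
  cancel = ℤSolver.solve-∀

nonzero-period-unique : ∀ D → NonzeroLP D → ∀ i j → (∀ x → pcoeff D (x ℤ.- + i) ≡ pcoeff D (x ℤ.- + j)) → i ≡ j
nonzero-period-unique D nz i j h with ℕP.<-cmp i j
... | tri≈ _ i≡j _ = i≡j
... | tri< i<j _ _ = contradiction (shifted-period (pcoeff D) (ℕP.<⇒≤ i<j) h)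
                       (nonzero-not-periodic D nz (j ∸ i) (ℕP.m<n⇒0<n∸m i<j))
... | tri> _ _ j<i = contradiction (shifted-period (pcoeff D) (ℕP.<⇒≤ j<i) (λ x → sym (h x)))
                       (nonzero-not-periodic D nz (i ∸ j) (ℕP.m<n⇒0<n∸m j<i))

nonzero-shift : ∀ D → NonzeroLP D → ∀ s → ¬ (∀ x → pcoeff D (x ℤ.- s) ≡ 0ℚ)
nonzero-shift D (y₀ , nz) s h = nz (trans (cong (pcoeff D) (sym (cancel y₀ s))) (h (y₀ ℤ.+ s)))
  where
  cancel : ∀ y s → y ℤ.+ s ℤ.- s ≡ y
  cancel = ℤSolver.solve-∀

-- Class functionals

indicator : {A : Set} → Dec A → ℚ
indicator (yes _) = 1ℚ
indicator (no _)  = 0ℚ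

indicator-cong : {A B : Set} (dA : Dec A) (dB : Dec B) → (A → B) → (B → A) → indicator dA ≡ indicator dB
indicator-cong (yes _) (yes _) _   _   = refl
indicator-cong (yes a) (no ¬b) A→B _   = contradiction (A→B a) ¬b
indicator-cong (no ¬a) (yes b) _   B→A = contradiction (B→A b) ¬a
indicator-cong (no _)  (no _)  _   _   = refl

indicator-yes : {A : Set} (dA : Dec A) → A → indicator dA ≡ 1ℚ
indicator-yes (yes _) _ = refl
indicator-yes (no ¬a) a = contradiction a ¬a

indicator-no : {A : Set} (dA : Dec A) → ¬ A → indicator dA ≡ 0ℚ
indicator-no (yes a) ¬a = contradiction a ¬a
indicator-no (no _)  _  = refl

-- As a functional on monomials q^{e′} u, it is invariant under swapping two adjacent letters that are not
-- k apart (with the matching power of q), hence kills the ideal.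
classFunctional : ℕ → Word N → ℤ → ℤ → Word N → ℚ
classFunctional k w e e′ u = indicator (KRearrangement? k w u ×-dec (e′ ℤ.+ + inv k u ℤ.≟ e))

classFunctional-cong : ∀ {e e′ e″} {u v : Word N} →
  (KRearrangement k w u → KRearrangement k w v) → (KRearrangement k w v → KRearrangement k w u) →
  e′ ℤ.+ + inv k u ≡ e″ ℤ.+ + inv k v → classFunctional k w e e′ u ≡ classFunctional k w e e″ v
classFunctional-cong {k = k} {w = w} {e} {e′} {e″} {u} {v} u→v v→u eq =
  indicator-cong (KRearrangement? k w u ×-dec (e′ ℤ.+ + inv k u ℤ.≟ e))
                 (KRearrangement? k w v ×-dec (e″ ℤ.+ + inv k v ℤ.≟ e))
                 (λ (r , p) → u→v r , trans (sym eq) p) (λ (r , p) → v→u r , trans eq p)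

classFunctional-swap : ∀ {c} x {y e e′ e″} → ¬ KApart k a c →
  e′ ℤ.+ + inv k (x ++ a ∷ c ∷ y) ≡ e″ ℤ.+ + inv k (x ++ c ∷ a ∷ y) →
  classFunctional k w e e′ (x ++ a ∷ c ∷ y) ≡ classFunctional k w e e″ (x ++ c ∷ a ∷ y)
classFunctional-swap x {y} {e} {e′} {e″} ¬apart = classFunctional-cong {e = e} {e′ = e′} {e″ = e″}
  (KRearrangement-swap x ¬apart) (KRearrangement-swap x (λ apart → ¬apart (KApart-sym apart)))

HasRepeat-++ : ∀ x {y} → HasRepeat w → HasRepeat (x ++ w ++ y)
HasRepeat-++ x {y} (a , p , m , s , refl) = a , x ++ p , m , s ++ y , (begin
  x ++ (p ++ a ∷ m ++ a ∷ s) ++ y     ≡⟨ cong (x ++_) (LP.++-assoc p (a ∷ m ++ a ∷ s) y) ⟩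
  x ++ p ++ a ∷ (m ++ a ∷ s) ++ y     ≡⟨ cong (λ L → x ++ p ++ a ∷ L) (LP.++-assoc m (a ∷ s) y) ⟩
  x ++ p ++ a ∷ m ++ a ∷ s ++ y       ≡⟨ LP.++-assoc x p _ ⟨
  (x ++ p) ++ a ∷ m ++ a ∷ s ++ y     ∎)
  where open ≡-Reasoning

classFunctional-nonunique : ∀ k (w : Word N) e e′ {u} → ¬ Unique u → classFunctional k w e e′ u ≡ 0ℚ
classFunctional-nonunique k w e e′ {u} ¬uu =
  indicator-no (KRearrangement? k w u ×-dec (e′ ℤ.+ + inv k u ℤ.≟ e)) (λ (r , _) → ¬uu (proj₁ r))

two-term-cancels : ∀ c {K₁ K₂} → K₁ ≡ K₂ → c ℚ.* 1ℚ ℚ.* K₁ ℚ.+ (c ℚ.* ℚ.- 1ℚ ℚ.* K₂ ℚ.+ 0ℚ) ≡ 0ℚ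
two-term-cancels c {K} refl = cancel c K
  where
  cancel : ∀ c K → c ℚ.* 1ℚ ℚ.* K ℚ.+ (c ℚ.* ℚ.- 1ℚ ℚ.* K ℚ.+ 0ℚ) ≡ 0ℚ
  cancel = solve 2 (λ c K → c :* con 1ℚ :* K :+ (c :* con (ℚ.- 1ℚ) :* K :+ con 0ℚ) := con 0ℚ) refl
    where open ℚSolver.+-*-Solver

kills-instance : ∀ {w : Word N} {e} (g : GenInst N k) → evaluate (classFunctional k w e) (expand g) ≡ 0ℚ
kills-instance {k = k} {w = w} {e}
  record { coef = c₀ ; expo = e′ ; left = x ; isGen = comm a c far ; right = y } =
  two-term-cancels c₀ (classFunctional-swap x {y} {e} {e′ ℤ.+ + 0} {e′ ℤ.+ + 0} (KApart-far far)
    (cong (λ n → e′ ℤ.+ + 0 ℤ.+ + n) (inv-swap-far far x y)))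
kills-instance {k = k} {w = w} {e}
  record { coef = c₀ ; expo = e′ ; left = x ; isGen = qcomm a b a<b b<a+k ; right = y } =
  two-term-cancels c₀ (classFunctional-swap x {y} {e} {e′ ℤ.+ + 0} {e′ ℤ.+ -[1+ 0 ]} (KApart-near a<b b<a+k)
    (trans (shift e′ _) (cong (λ n → e′ ℤ.+ -[1+ 0 ] ℤ.+ + n) (inv-swap-near a<b b<a+k x y))))
  where
  shift : ∀ (E X : ℤ) → E ℤ.+ + 0 ℤ.+ X ≡ E ℤ.+ -[1+ 0 ] ℤ.+ (+ 1 ℤ.+ X)
  shift = ℤSolver.solve-∀
kills-instance {k = k} {w = w} {e}
  record { coef = c₀ ; expo = e′ ; left = x ; isGen = rep u r ; right = y } = begin
  c₀ ℚ.* 1ℚ ℚ.* classFunctional k w e (e′ ℤ.+ + 0) (x ++ u ++ y) ℚ.+ 0ℚ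
    ≡⟨ cong (λ K → c₀ ℚ.* 1ℚ ℚ.* K ℚ.+ 0ℚ)
         (classFunctional-nonunique k w e (e′ ℤ.+ + 0) (repeat⇒¬unique (HasRepeat-++ x r))) ⟩
  c₀ ℚ.* 1ℚ ℚ.* 0ℚ ℚ.+ 0ℚ
    ≡⟨ trans (ℚP.+-identityʳ _) (ℚP.*-zeroʳ (c₀ ℚ.* 1ℚ)) ⟩
  0ℚ ∎
  where open ≡-Reasoning

kills-instances : ∀ {w : Word N} {e} (gs : List (GenInst N k)) →
  evaluate (classFunctional k w e) (concatMap expand gs) ≡ 0ℚ
kills-instances []       = refl
kills-instances (g ∷ gs) = trans (evaluate-++ _ (expand g) (concatMap expand gs))
  (trans (cong₂ ℚ._+_ (kills-instance g) (kills-instances gs)) (ℚP.+-identityʳ 0ℚ))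

classFunctional-shift : ∀ k (w : Word N) e d e′ u → classFunctional k w e (d ℤ.+ e′) u ≡ classFunctional k w (e ℤ.- d) e′ u
classFunctional-shift k w e d e′ u =
  indicator-cong (KRearrangement? k w u ×-dec (d ℤ.+ e′ ℤ.+ + inv k u ℤ.≟ e))
                 (KRearrangement? k w u ×-dec (e′ ℤ.+ + inv k u ℤ.≟ e ℤ.- d))
                 (λ (r , p) → r , trans (sym (cancelˡ d e′ _)) (cong (ℤ._- d) p))
                 (λ (r , p) → r , trans (assoc d e′ _) (trans (cong (ℤ._+_ d) p) (restore d e)))
  where
  cancelˡ : ∀ d e′ i → d ℤ.+ e′ ℤ.+ i ℤ.- d ≡ e′ ℤ.+ i
  cancelˡ = ℤSolver.solve-∀
  assoc : ∀ d e′ i → d ℤ.+ e′ ℤ.+ i ≡ d ℤ.+ (e′ ℤ.+ i)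
  assoc = ℤSolver.solve-∀
  restore : ∀ d e → d ℤ.+ (e ℤ.- d) ≡ e
  restore = ℤSolver.solve-∀

evaluate-scale-single : ∀ k (w : Word N) e c d f →
  evaluate (classFunctional k w e) (scale ((c , d) ∷ []) f) ≡ c ℚ.* evaluate (classFunctional k w (e ℤ.- d)) f
evaluate-scale-single k w e c d [] = sym (ℚP.*-zeroʳ c)
evaluate-scale-single k w e c d ((c′ , e′ , u) ∷ f) = trans
  (cong₂ ℚ._+_ (trans (cong (c ℚ.* c′ ℚ.*_) (classFunctional-shift k w e d e′ u)) (ℚP.*-assoc c c′ _))
               (evaluate-scale-single k w e c d f))
  (sym (ℚP.*-distribˡ-+ c (c′ ℚ.* classFunctional k w (e ℤ.- d) e′ u) _))

evaluate-scale : ∀ k (w : Word N) e D f →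
  evaluate (classFunctional k w e) (scale D f) ≡ weightedSum D (λ d → evaluate (classFunctional k w (e ℤ.- d)) f)
evaluate-scale k w e []            f = refl
evaluate-scale k w e ((c , d) ∷ D) f = begin
  evaluate φ (scale ((c , d) ∷ D) f)
    ≡⟨ cong (evaluate φ) split ⟩
  evaluate φ (scale ((c , d) ∷ []) f ++ scale D f)
    ≡⟨ evaluate-++ φ (scale ((c , d) ∷ []) f) (scale D f) ⟩
  evaluate φ (scale ((c , d) ∷ []) f) ℚ.+ evaluate φ (scale D f)
    ≡⟨ cong₂ ℚ._+_ (evaluate-scale-single k w e c d f) (evaluate-scale k w e D f) ⟩
  c ℚ.* evaluate (classFunctional k w (e ℤ.- d)) f ℚ.+ weightedSum D (λ d → evaluate (classFunctional k w (e ℤ.- d)) f) ∎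
  where
  open ≡-Reasoning
  φ : ℤ → Word _ → ℚ
  φ = classFunctional k w e
  split : scale ((c , d) ∷ D) f ≡ scale ((c , d) ∷ []) f ++ scale D f
  split = cong (_++ scale D f) (sym (LP.++-identityʳ _))

Annihilated : ℕ → Word N → LinComb N → Set
Annihilated k w f = Σ LPoly λ D → NonzeroLP D ×
  (∀ x → weightedSum D (λ d → evaluate (classFunctional k w (x ℤ.- d)) f) ≡ 0ℚ)

InJ⇒annihilated : ∀ {f : LinComb N} → InJ N k f → (w : Word N) → Annihilated k w f
InJ⇒annihilated {k = k} {f = f} (D , nz , gs , gs≋Df) w = D , nz , λ x → begin
  weightedSum D (λ d → evaluate (classFunctional k w (x ℤ.- d)) f) ≡⟨ evaluate-scale k w x D f ⟨
  evaluate (classFunctional k w x) (scale D f)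
    ≡⟨ evaluate-resp-≋ (classFunctional k w x) (concatMap expand gs) (scale D f) gs≋Df ⟨
  evaluate (classFunctional k w x) (concatMap expand gs)            ≡⟨ kills-instances gs ⟩
  0ℚ                                                                ∎
  where open ≡-Reasoning

evaluate-word : ∀ (K : ℤ → Word N → ℚ) u → evaluate K (word u) ≡ K (+ 0) u
evaluate-word K u = trans (ℚP.+-identityʳ _) (ℚP.*-identityˡ (K (+ 0) u))

evaluate-⊖ : ∀ (K : ℤ → Word N → ℚ) u v → evaluate K (u ⊖ v) ≡ K (+ 0) u ℚ.- K (+ 0) v
evaluate-⊖ K u v = cong₂ ℚ._+_ (ℚP.*-identityˡ (K (+ 0) u))
  (trans (ℚP.+-identityʳ _) (trans (sym (ℚP.neg-distribˡ-* 1ℚ (K (+ 0) v))) (cong ℚ.-_ (ℚP.*-identityˡ (K (+ 0) v)))))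

weightedSum-classFunctional : KRearrangement k w u → ∀ D x →
  weightedSum D (λ d → classFunctional k w (x ℤ.- d) (+ 0) u) ≡ pcoeff D (x ℤ.- + inv k u)
weightedSum-classFunctional {k = k} {w = w} {u = u} r D x = weightedSum-point D _ (x ℤ.- + inv k u)
  (λ d d≡ → indicator-yes (KRearrangement? k w u ×-dec (+ 0 ℤ.+ + inv k u ℤ.≟ x ℤ.- d))
              (r , trans (ℤP.+-identityˡ _) (trans (sym (twice x (+ inv k u))) (cong (ℤ._-_ x) (sym d≡)))))
  (λ d d≢ → indicator-no (KRearrangement? k w u ×-dec (+ 0 ℤ.+ + inv k u ℤ.≟ x ℤ.- d))
              (λ (_ , eq) → d≢ (trans (sym (twice x d)) (cong (ℤ._-_ x) (trans (sym eq) (ℤP.+-identityˡ _))))))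
  where
  twice : ∀ x i → x ℤ.- (x ℤ.- i) ≡ i
  twice = ℤSolver.solve-∀

weightedSum-classFunctional-¬ : ¬ KRearrangement k w u → ∀ D x →
  weightedSum D (λ d → classFunctional k w (x ℤ.- d) (+ 0) u) ≡ 0ℚ
weightedSum-classFunctional-¬ {k = k} {w = w} {u = u} ¬r D x = weightedSum-zero D _
  λ d → indicator-no (KRearrangement? k w u ×-dec (+ 0 ℤ.+ + inv k u ℤ.≟ x ℤ.- d)) (¬r ∘ proj₁)

unique⇒nonzero : Unique u → NonzeroWord N k u
unique⇒nonzero {u = u} {k = k} uu ij = contradiction zeros (nonzero-shift D nz (+ inv k u))
  where
  annihilated : Annihilated k u (word u)
  annihilated = InJ⇒annihilated ij u
  D : LPoly
  D = proj₁ annihilated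
  nz : NonzeroLP D
  nz = proj₁ (proj₂ annihilated)
  zeros : ∀ x → pcoeff D (x ℤ.- + inv k u) ≡ 0ℚ
  zeros x = begin
    pcoeff D (x ℤ.- + inv k u)
      ≡⟨ weightedSum-classFunctional (KRearrangement-refl uu) D x ⟨
    weightedSum D (λ d → classFunctional k u (x ℤ.- d) (+ 0) u)
      ≡⟨ weightedSum-cong D (λ d → evaluate-word (classFunctional k u (x ℤ.- d)) u) ⟨
    weightedSum D (λ d → evaluate (classFunctional k u (x ℤ.- d)) (word u))
      ≡⟨ proj₂ (proj₂ annihilated) x ⟩
    0ℚ ∎
    where open ≡-Reasoning

weightedSum-classFunctional-⊖ : Unique w → ∀ D x →
  weightedSum D (λ d → evaluate (classFunctional k w (x ℤ.- d)) (u ⊖ w)) ≡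
  weightedSum D (λ d → classFunctional k w (x ℤ.- d) (+ 0) u) ℚ.- pcoeff D (x ℤ.- + inv k w)
weightedSum-classFunctional-⊖ {w = w} {k = k} {u = u} uw D x = begin
  weightedSum D (λ d → evaluate (φ d) (u ⊖ w))                   ≡⟨ weightedSum-cong D (λ d → evaluate-⊖ (φ d) u w) ⟩
  weightedSum D (λ d → φ d (+ 0) u ℚ.- φ d (+ 0) w)               ≡⟨ weightedSum-- D (λ d → φ d (+ 0) u) (λ d → φ d (+ 0) w) ⟩
  weightedSum D (λ d → φ d (+ 0) u) ℚ.- weightedSum D (λ d → φ d (+ 0) w)
    ≡⟨ cong (ℚ._-_ (weightedSum D (λ d → φ d (+ 0) u))) (weightedSum-classFunctional (KRearrangement-refl {k = k} uw) D x) ⟩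
  weightedSum D (λ d → φ d (+ 0) u) ℚ.- pcoeff D (x ℤ.- + inv k w) ∎
  where
  open ≡-Reasoning
  φ : ℤ → ℤ → Word _ → ℚ
  φ d = classFunctional k w (x ℤ.- d)

ideal⇒KRearrangement : Unique w → InJ N k (u ⊖ w) → KRearrangement k w u × inv k u ≡ inv k w
ideal⇒KRearrangement {w = w} {k = k} {u = u} uw ij = by-cases (InJ⇒annihilated ij w) (KRearrangement? k w u)
  where
  by-cases : Annihilated k w (u ⊖ w) → Dec (KRearrangement k w u) → KRearrangement k w u × inv k u ≡ inv k w
  by-cases (D , nz , vanish) (yes r) = r , nonzero-period-unique D nz (inv k u) (inv k w) λ x →
    ℚ-Group.x∙y⁻¹≈ε⇒x≈y _ _ (begin
      pcoeff D (x ℤ.- + inv k u) ℚ.- pcoeff D (x ℤ.- + inv k w)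
        ≡⟨ cong (ℚ._- pcoeff D (x ℤ.- + inv k w)) (weightedSum-classFunctional r D x) ⟨
      weightedSum D (λ d → classFunctional k w (x ℤ.- d) (+ 0) u) ℚ.- pcoeff D (x ℤ.- + inv k w)
        ≡⟨ weightedSum-classFunctional-⊖ {u = u} uw D x ⟨
      weightedSum D (λ d → evaluate (classFunctional k w (x ℤ.- d)) (u ⊖ w))
        ≡⟨ vanish x ⟩
      0ℚ ∎)
    where open ≡-Reasoning
  by-cases (D , nz , vanish) (no ¬r) = contradiction (λ x → ℚP.neg-injective (begin
    ℚ.- pcoeff D (x ℤ.- + inv k w)
      ≡⟨ ℚP.+-identityˡ _ ⟨
    0ℚ ℚ.- pcoeff D (x ℤ.- + inv k w)
      ≡⟨ cong (ℚ._- pcoeff D (x ℤ.- + inv k w)) (weightedSum-classFunctional-¬ ¬r D x) ⟨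
    weightedSum D (λ d → classFunctional k w (x ℤ.- d) (+ 0) u) ℚ.- pcoeff D (x ℤ.- + inv k w)
      ≡⟨ weightedSum-classFunctional-⊖ {u = u} uw D x ⟨
    weightedSum D (λ d → evaluate (classFunctional k w (x ℤ.- d)) (u ⊖ w))
      ≡⟨ vanish x ⟩
    0ℚ ∎)) (nonzero-shift D nz (+ inv k w))
    where open ≡-Reasoning

one : LPoly
one = (1ℚ , + 0) ∷ []

one-nonzero : NonzeroLP one
one-nonzero = + 0 , λ ()

Congruent⇒InJ : Congruent k (+ 0 , u) (+ 0 , v) → InJ N k (u ⊖ v)
Congruent⇒InJ (gs by gs≋) = one , one-nonzero , gs , gs≋

repeat⇒InJ : HasRepeat u → InJ N k (word u)
repeat⇒InJ {u = u} {k = k} r = one , one-nonzero , instanceAt (+ 0) [] [] (rep u r) ∷ [] ,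
  λ e w → cong (λ L → coeff ((1ℚ , + 0 , L) ∷ []) e w) (LP.++-identityʳ u)

nonzero⇒unique : NonzeroWord N k u → Unique u
nonzero⇒unique {u = u} nz with unique-or-repeat u
... | inj₁ uu = uu
... | inj₂ r  = contradiction (repeat⇒InJ r) nz

KRearrangement⇒InJ : Unique w → KRearrangement k w u → inv k u ≡ inv k w → InJ N k (u ⊖ w)
KRearrangement⇒InJ {w = w} {k = k} {u = u} uw r inv≡ = Congruent⇒InJ (Congruent-exponents
  (trans (cong (λ n → + inv k w ℤ.- + n) inv≡) (ℤP.+-inverseʳ (+ inv k w))) (ℤP.+-inverseʳ (+ inv k w))
  (KRearrangement-balanced (proj₁ r) (KRearrangement-sym uw r) (+ inv k w) []))

-- Skew shapes

part-≤-head : ∀ {x xs} → Linked.Linked ℕ._≥_ (x ∷ xs) → part xs 0 ≤ x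
part-≤-head Linked.[-]        = z≤n
part-≤-head (x≥y Linked.∷ _) = x≥y

part-antitone : ∀ {xs} → Linked.Linked ℕ._≥_ xs → ∀ {r r′} → r ≤ r′ → part xs r′ ≤ part xs r
part-antitone {[]}     _ _ = z≤n
part-antitone {x ∷ xs} l {zero}  {zero}   _         = ℕP.≤-refl
part-antitone {x ∷ xs} l {zero}  {suc r′} _         = ℕP.≤-trans (part-antitone (Linked.tail l) z≤n) (part-≤-head l)
part-antitone {x ∷ xs} l {suc r} {suc r′} (s≤s r≤r′) = part-antitone (Linked.tail l) r≤r′

antitone-by-steps : (f : ℕ → ℕ) → (∀ n → f (suc n) ≤ f n) → ∀ {m n} → m ≤ n → f n ≤ f m
antitone-by-steps f f-step m≤n = go (ℕP.≤⇒≤′ m≤n)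
  where
  go : ∀ {m n} → m ℕ.≤′ n → f n ≤ f m
  go ℕ.≤′-refl       = ℕP.≤-refl
  go (ℕ.≤′-step m≤n) = ℕP.≤-trans (f-step _) (go m≤n)

monotone-by-steps : (f : ℕ → ℕ) → (∀ n → f n ≤ f (suc n)) → ∀ {m n} → m ≤ n → f m ≤ f n
monotone-by-steps f f-step m≤n = go (ℕP.≤⇒≤′ m≤n)
  where
  go : ∀ {m n} → m ℕ.≤′ n → f m ≤ f n
  go ℕ.≤′-refl       = ℕP.≤-refl
  go (ℕ.≤′-step m≤n) = ℕP.≤-trans (go m≤n) (f-step _)

part-applyUpTo : ∀ (f : ℕ → ℕ) n r → r < n → part (applyUpTo f n) r ≡ f r
part-applyUpTo f (suc n) zero    _         = refl
part-applyUpTo f (suc n) (suc r) (s≤s r<n) = part-applyUpTo (f ∘ suc) n r r<n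

part-applyUpTo-beyond : ∀ (f : ℕ → ℕ) n r → n ≤ r → part (applyUpTo f n) r ≡ 0
part-applyUpTo-beyond f zero    r       _         = refl
part-applyUpTo-beyond f (suc n) (suc r) (s≤s n≤r) = part-applyUpTo-beyond (f ∘ suc) n r n≤r

applyUpTo-linked : ∀ (f : ℕ → ℕ) n → (∀ r → f (suc r) ≤ f r) → Linked.Linked ℕ._≥_ (applyUpTo f n)
applyUpTo-linked f zero          _      = Linked.[]
applyUpTo-linked f (suc zero)    _      = Linked.[-]
applyUpTo-linked f (suc (suc n)) f-step = f-step 0 Linked.∷ applyUpTo-linked (f ∘ suc) (suc n) (f-step ∘ suc)

∈S-convex : ∀ sh {r₁ c₁ r₂ c₂ r c} → (r₁ , c₁) ∈S sh → (r₂ , c₂) ∈S sh →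
  r₁ ≤ r → r ≤ r₂ → c₁ ≤ c → c ≤ c₂ → (r , c) ∈S sh
∈S-convex sh (in₁ , out₁) (in₂ , out₂) r₁≤r r≤r₂ c₁≤c c≤c₂ =
  ℕP.≤-trans (part-antitone (SkewShape.innerPart sh) r₁≤r) (ℕP.≤-trans in₁ c₁≤c) ,
  ℕP.<-≤-trans (ℕP.≤-<-trans c≤c₂ out₂) (part-antitone (SkewShape.outerPart sh) r≤r₂)

No2x2⇒¬southeast : ∀ sh → No2x2 sh → ∀ {r₁ c₁ r₂ c₂} → (r₁ , c₁) ∈S sh → (r₂ , c₂) ∈S sh →
  r₁ < r₂ → ¬ c₁ < c₂
No2x2⇒¬southeast sh no2x2 {r₁} {c₁} z₁ z₂ r₁<r₂ c₁<c₂ = no2x2 r₁ c₁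
  ( z₁
  , ∈S-convex sh z₁ z₂ ℕP.≤-refl (ℕP.<⇒≤ r₁<r₂) (ℕP.n≤1+n c₁) c₁<c₂
  , ∈S-convex sh z₁ z₂ (ℕP.n≤1+n r₁) r₁<r₂ ℕP.≤-refl (ℕP.<⇒≤ c₁<c₂)
  , ∈S-convex sh z₁ z₂ (ℕP.n≤1+n r₁) r₁<r₂ (ℕP.n≤1+n c₁) c₁<c₂ )

same-content⇒same-cell : ∀ sh → No2x2 sh → ∀ {r c r′ c′} → (r , c) ∈S sh → (r′ , c′) ∈S sh →
  c + r′ ≡ c′ + r → (r , c) ≡ (r′ , c′)
same-content⇒same-cell sh no2x2 {r} {c} {r′} {c′} z z′ eq with ℕP.<-cmp r r′
... | tri≈ _ refl _ = cong (r ,_) (ℕP.+-cancelʳ-≡ r c c′ eq)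
... | tri< r<r′ _ _ = contradiction
  (ℕP.+-cancelʳ-< r c c′ (ℕP.<-≤-trans (ℕP.+-monoʳ-< c r<r′) (ℕP.≤-reflexive eq)))
  (No2x2⇒¬southeast sh no2x2 z z′ r<r′)
... | tri> _ _ r′<r = contradiction
  (ℕP.+-cancelʳ-< r′ c′ c (ℕP.<-≤-trans (ℕP.+-monoʳ-< c′ r′<r) (ℕP.≤-reflexive (sym eq))))
  (No2x2⇒¬southeast sh no2x2 z′ z r′<r)

consecutive-content⇒adjacent : ∀ sh → No2x2 sh → ∀ {r c r′ c′} → (r , c) ∈S sh → (r′ , c′) ∈S sh →
  c′ + r ≡ suc (c + r′) → Adjacent (r , c) (r′ , c′) ⊎ Adjacent (r′ , c′) (r , c)
consecutive-content⇒adjacent sh no2x2 {r} {c} {r′} {c′} z z′ eq with ℕP.<-cmp r r′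
... | tri≈ _ refl _ = inj₁ (inj₁ (refl , ℕP.+-cancelʳ-≡ r c′ (suc c) eq))
... | tri< r<r′ _ _ = contradiction
  (ℕP.+-cancelʳ-< r c c′ (ℕP.<-≤-trans (s≤s (ℕP.+-monoʳ-≤ c (ℕP.<⇒≤ r<r′))) (ℕP.≤-reflexive (sym eq))))
  (No2x2⇒¬southeast sh no2x2 z z′ r<r′)
... | tri> _ _ r′<r with r ℕ.≟ suc r′
...   | yes refl = inj₂ (inj₂ (refl , ℕP.suc-injective (ℕP.+-cancelʳ-≡ r′ (suc c) (suc c′)
                     (trans (sym eq) (ℕP.+-suc c′ r′)))))
...   | no r≢1+r′ = contradiction c′<c (No2x2⇒¬southeast sh no2x2 z′ z r′<r)
  where
  shift : ∀ c r → suc (suc c + r) ≡ c + suc (suc r)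
  shift = solve-∀
  c′<c : c′ < c
  c′<c = ℕP.+-cancelʳ-≤ r′ (suc c′) c (ℕP.≤-pred (begin
    suc (suc c′ + r′)   ≡⟨ shift c′ r′ ⟩
    c′ + suc (suc r′)   ≤⟨ ℕP.+-monoʳ-≤ c′ (ℕP.≤∧≢⇒< r′<r (r≢1+r′ ∘ sym)) ⟩
    c′ + r              ≡⟨ eq ⟩
    suc (c + r′)        ∎))
    where open ℕP.≤-Reasoning

part<length : ∀ xs r → 0 < part xs r → r < length xs
part<length (x ∷ xs) zero    _ = s≤s z≤n
part<length (x ∷ xs) (suc r) p = s≤s (part<length xs r p)

∈-cells⁻ : ∀ sh {z} → z ∈ cells sh → z ∈S sh
∈-cells⁻ sh z∈ with find (∈P.∈-concatMap⁻ _ {xs = upTo (length (SkewShape.outer sh))} z∈)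
... | r , _ , z∈row with ∈P.∈-map⁻ _ z∈row
...   | j , j∈ , refl = ℕP.m≤m+n (part inner r) j ,
        ℕP.<-≤-trans (ℕP.+-monoʳ-< (part inner r) (∈-upTo⁻ j∈)) (ℕP.≤-reflexive (ℕP.m+[n∸m]≡n (contained r)))
  where open SkewShape sh

∈-cells⁺ : ∀ sh {r c} → (r , c) ∈S sh → (r , c) ∈ cells sh
∈-cells⁺ sh {r} {c} (inner≤c , c<outer) = ∈P.∈-concatMap⁺ _ {xs = upTo (length outer)}
  (lose (∈-upTo⁺ (part<length outer r (ℕP.≤-<-trans z≤n c<outer)))
    (subst (λ c′ → (r , c′) ∈ _) (ℕP.m+[n∸m]≡n inner≤c)
      (∈P.∈-map⁺ _ (∈-upTo⁺ (ℕP.∸-monoˡ-< c<outer inner≤c)))))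
  where open SkewShape sh

unique-cells : ∀ sh → Unique (cells sh)
unique-cells sh = unique-concatMap _ (UniqueP.upTo⁺ (length outer))
  (λ r _ → unique-map _ (UniqueP.upTo⁺ _) (λ _ _ eq → ℕP.+-cancelˡ-≡ (part inner r) _ _ (cong proj₂ eq)))
  (λ r≢r′ (z∈ , z∈′) → r≢r′ (trans (sym (row z∈)) (row z∈′)))
  where
  open SkewShape sh
  row : ∀ {r z} → z ∈ map (λ j → (r , part inner r + j)) (upTo (part outer r ∸ part inner r)) → proj₁ z ≡ r
  row z∈ with ∈P.∈-map⁻ _ z∈
  ... | _ , _ , refl = refl

multiple-bound : ∀ k m t → k ≤ k ℕ.* suc m + t
multiple-bound k m t = ℕP.≤-trans (ℕP.m≤m+n k (k ℕ.* m)) (ℕP.≤-trans (ℕP.≤-reflexive (sym (ℕP.*-suc k m))) (ℕP.m≤m+n _ t))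

residue-step : ∀ k (i j : Fin k) d → + k ℤ.* d ℤ.+ + toℕ i ≡ + toℕ j → d ≡ + 0 × i ≡ j
residue-step k i j (+ zero) h =
  refl , FinP.toℕ-injective (ℤP.+-injective (trans (sym (cong (ℤ._+ + toℕ i) (ℤP.*-zeroʳ (+ k)))) h))
residue-step k i j (+ suc m) h = contradiction (subst (k ≤_) eq (multiple-bound k m (toℕ i))) (ℕP.<⇒≱ (FinP.toℕ<n j))
  where
  eq : k ℕ.* suc m + toℕ i ≡ toℕ j
  eq = ℤP.+-injective (trans (ℤP.pos-+ (k ℕ.* suc m) (toℕ i)) (trans (cong (ℤ._+ + toℕ i) (ℤP.pos-* k (suc m))) h))
residue-step k i j -[1+ m ] h = contradiction
  (subst (k ≤_) eq (ℕP.≤-trans (multiple-bound k m (toℕ j)) (ℕP.≤-reflexive (ℕP.+-comm _ (toℕ j)))))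
  (ℕP.<⇒≱ (FinP.toℕ<n i))
  where
  move : ∀ K D I → I ≡ (K ℤ.* D ℤ.+ I) ℤ.+ K ℤ.* (ℤ.- D)
  move = ℤSolver.solve-∀
  eq : toℕ j + k ℕ.* suc m ≡ toℕ i
  eq = ℤP.+-injective (trans (ℤP.pos-+ (toℕ j) _) (trans (cong (ℤ._+_ (+ toℕ j)) (ℤP.pos-* k (suc m)))
         (sym (trans (move (+ k) -[1+ m ] (+ toℕ i)) (cong (ℤ._+ (+ k ℤ.* + suc m)) h)))))

residue-unique : ∀ k (i j : Fin k) x y → + k ℤ.* x ℤ.+ + toℕ i ≡ + k ℤ.* y ℤ.+ + toℕ j → i ≡ j × x ≡ y
residue-unique k i j x y h = let x-y≡0 , i≡j = residue-step k i j (x ℤ.- y) step in i≡j , ℤP.i-j≡0⇒i≡j x y x-y≡0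
  where
  difference : ∀ K x y I → K ℤ.* (x ℤ.- y) ℤ.+ I ≡ (K ℤ.* x ℤ.+ I) ℤ.- K ℤ.* y
  difference = ℤSolver.solve-∀
  cancel : ∀ K y J → (K ℤ.* y ℤ.+ J) ℤ.- K ℤ.* y ≡ J
  cancel = ℤSolver.solve-∀
  step : + k ℤ.* (x ℤ.- y) ℤ.+ + toℕ i ≡ + toℕ j
  step = trans (difference (+ k) x y (+ toℕ i)) (trans (cong (ℤ._- + k ℤ.* y) h) (cancel (+ k) y (+ toℕ j)))

shc-injective : ∀ k (i j : Fin k) z z′ → shc k i z ≡ shc k j z′ → i ≡ j × content z ≡ content z′
shc-injective k i j z z′ = residue-unique k i j (content z) (content z′)

shc-+k : ∀ k (i j : Fin k) z z′ → shc k i z ℤ.+ + k ≡ shc k j z′ → i ≡ j × content z ℤ.+ + 1 ≡ content z′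
shc-+k k i j z z′ h = residue-unique k i j (content z ℤ.+ + 1) (content z′) (trans (regroup (+ k) (content z) (+ toℕ i)) h)
  where
  regroup : ∀ K c I → K ℤ.* (c ℤ.+ + 1) ℤ.+ I ≡ K ℤ.* c ℤ.+ I ℤ.+ K
  regroup = ℤSolver.solve-∀

content-≡ : ∀ r c r′ c′ → content (r , c) ≡ content (r′ , c′) → c + r′ ≡ c′ + r
content-≡ r c r′ c′ h = ℤP.+-injective (begin
  + (c + r′)                        ≡⟨ ℤP.pos-+ c r′ ⟩
  + c ℤ.+ + r′                      ≡⟨ regroup (+ c) (+ r) (+ r′) ⟩
  (+ c ℤ.- + r) ℤ.+ (+ r ℤ.+ + r′)  ≡⟨ cong (ℤ._+ (+ r ℤ.+ + r′)) h ⟩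
  (+ c′ ℤ.- + r′) ℤ.+ (+ r ℤ.+ + r′) ≡⟨ regroup′ (+ c′) (+ r′) (+ r) ⟩
  + c′ ℤ.+ + r                      ≡⟨ ℤP.pos-+ c′ r ⟨
  + (c′ + r)                        ∎)
  where
  open ≡-Reasoning
  regroup : ∀ c r r′ → c ℤ.+ r′ ≡ (c ℤ.- r) ℤ.+ (r ℤ.+ r′)
  regroup = ℤSolver.solve-∀
  regroup′ : ∀ c′ r′ r → (c′ ℤ.- r′) ℤ.+ (r ℤ.+ r′) ≡ c′ ℤ.+ r
  regroup′ = ℤSolver.solve-∀

content-suc : ∀ r c r′ c′ → content (r , c) ℤ.+ + 1 ≡ content (r′ , c′) → c′ + r ≡ suc (c + r′)
content-suc r c r′ c′ h = ℤP.+-injective (begin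
  + (c′ + r)                              ≡⟨ ℤP.pos-+ c′ r ⟩
  + c′ ℤ.+ + r                            ≡⟨ regroup (+ c′) (+ r′) (+ r) ⟩
  (+ c′ ℤ.- + r′) ℤ.+ (+ r′ ℤ.+ + r)      ≡⟨ cong (ℤ._+ (+ r′ ℤ.+ + r)) h ⟨
  (+ c ℤ.- + r ℤ.+ + 1) ℤ.+ (+ r′ ℤ.+ + r) ≡⟨ regroup′ (+ c) (+ r) (+ r′) ⟩
  + 1 ℤ.+ (+ c ℤ.+ + r′)                   ≡⟨ cong (ℤ._+_ (+ 1)) (ℤP.pos-+ c r′) ⟨
  + 1 ℤ.+ + (c + r′)                       ≡⟨ ℤP.pos-+ 1 (c + r′) ⟨
  + suc (c + r′)                           ∎)
  where
  open ≡-Reasoning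
  regroup : ∀ c′ r′ r → c′ ℤ.+ r ≡ (c′ ℤ.- r′) ℤ.+ (r′ ℤ.+ r)
  regroup = ℤSolver.solve-∀
  regroup′ : ∀ c r r′ → (c ℤ.- r ℤ.+ + 1) ℤ.+ (r′ ℤ.+ r) ≡ + 1 ℤ.+ (c ℤ.+ r′)
  regroup′ = ℤSolver.solve-∀

shc-adjacent : ∀ k (i : Fin k) z z′ → Adjacent z z′ →
  shc k i z ℤ.+ + k ≡ shc k i z′ ⊎ shc k i z′ ℤ.+ + k ≡ shc k i z
shc-adjacent k i (r , c) (_ , _) (inj₁ (refl , refl)) = inj₁ (begin
  + k ℤ.* (+ c ℤ.- + r) ℤ.+ + toℕ i ℤ.+ + k      ≡⟨ east (+ k) (+ c) (+ r) (+ toℕ i) ⟩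
  + k ℤ.* (+ 1 ℤ.+ + c ℤ.- + r) ℤ.+ + toℕ i     ≡⟨ cong (λ t → + k ℤ.* (t ℤ.- + r) ℤ.+ + toℕ i) (ℤP.pos-+ 1 c) ⟨
  shc k i (r , suc c)                           ∎)
  where
  open ≡-Reasoning
  east : ∀ K c r I → K ℤ.* (c ℤ.- r) ℤ.+ I ℤ.+ K ≡ K ℤ.* (+ 1 ℤ.+ c ℤ.- r) ℤ.+ I
  east = ℤSolver.solve-∀
shc-adjacent k i (r , c) (_ , _) (inj₂ (refl , refl)) = inj₂ (begin
  shc k i (suc r , c) ℤ.+ + k                      ≡⟨ cong (λ t → + k ℤ.* (+ c ℤ.- t) ℤ.+ + toℕ i ℤ.+ + k) (ℤP.pos-+ 1 r) ⟩
  + k ℤ.* (+ c ℤ.- (+ 1 ℤ.+ + r)) ℤ.+ + toℕ i ℤ.+ + k ≡⟨ south (+ k) (+ c) (+ r) (+ toℕ i) ⟩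
  shc k i (r , c)                                  ∎)
  where
  open ≡-Reasoning
  south : ∀ K c r I → K ℤ.* (c ℤ.- (+ 1 ℤ.+ r)) ℤ.+ I ℤ.+ K ≡ K ℤ.* (c ℤ.- r) ℤ.+ I
  south = ℤSolver.solve-∀

∈-shiftedContents⁻ : ∀ k (β : Fin k → SkewShape) {x} → x ∈ shiftedContents k β →
  ∃[ i ] ∃[ z ] (z ∈S β i × shc k i z ≡ x)
∈-shiftedContents⁻ k β x∈ with find (∈P.∈-concatMap⁻ _ {xs = allFin k} x∈)
... | i , _ , x∈i with ∈P.∈-map⁻ (shc k i) x∈i
...   | z , z∈ , refl = i , z , ∈-cells⁻ (β i) z∈ , refl

∈-shiftedContents⁺ : ∀ k (β : Fin k → SkewShape) i z → z ∈S β i → shc k i z ∈ shiftedContents k β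
∈-shiftedContents⁺ k β i z z∈ = ∈P.∈-concatMap⁺ _ {xs = allFin k}
  (lose (∈P.∈-allFin i) (∈P.∈-map⁺ (shc k i) (∈-cells⁺ (β i) z∈)))

unique-shiftedContents : ∀ k (β : Fin k → SkewShape) → (∀ i → No2x2 (β i)) → Unique (shiftedContents k β)
unique-shiftedContents k β no2x2 = unique-concatMap _ (UniqueP.allFin⁺ k)
  (λ i _ → unique-map (shc k i) (unique-cells (β i)) λ { {r , c} {r′ , c′} z∈ z′∈ eq →
     same-content⇒same-cell (β i) (no2x2 i) (∈-cells⁻ (β i) z∈) (∈-cells⁻ (β i) z′∈)
       (content-≡ r c r′ c′ (proj₂ (shc-injective k i i (r , c) (r′ , c′) eq))) })
  λ i≢j (x∈i , x∈j) → i≢j (same-residue x∈i x∈j)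
  where
  same-residue : ∀ {i j x} → x ∈ map (shc k i) (cells (β i)) → x ∈ map (shc k j) (cells (β j)) → i ≡ j
  same-residue {i} {j} x∈i x∈j with ∈P.∈-map⁻ (shc k i) x∈i | ∈P.∈-map⁻ (shc k j) x∈j
  ... | z , _ , refl | z′ , _ , eq = proj₁ (shc-injective k i j z z′ eq)

valℤ-injective : valℤ a ≡ valℤ b → a ≡ b
valℤ-injective = val-injective ∘ ℤP.+-injective

+k-valℤ : val a + k ≡ val b → valℤ a ℤ.+ + k ≡ valℤ b
+k-valℤ {a = a} {k = k} a+k≡b = trans (sym (ℤP.pos-+ (val a) k)) (cong +_ a+k≡b)

+k-val : valℤ a ℤ.+ + k ≡ valℤ b → val a + k ≡ val b
+k-val {a = a} {k = k} a+k≡b = ℤP.+-injective (trans (ℤP.pos-+ (val a) k) a+k≡b)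

OccursBefore-letters : ∀ {x y} (v : Word N) p s → map valℤ v ≡ p ++ x ∷ s → y ∈ s →
  ∃[ a ] ∃[ b ] (valℤ a ≡ x × valℤ b ≡ y × Before a b v)
OccursBefore-letters (a ∷ v) [] s eq y∈ with LP.∷-injective eq
... | a≡x , refl with ∈P.∈-map⁻ valℤ y∈
...   | b , b∈ , refl = a , b , a≡x , refl , now b∈
OccursBefore-letters (c ∷ v) (_ ∷ p) s eq y∈ with OccursBefore-letters v p s (proj₂ (LP.∷-injective eq)) y∈
... | a , b , a≡x , b≡y , ab = a , b , a≡x , b≡y , later ab

OccursBefore⇒Before : OccursBefore (valℤ a) (valℤ b) (map valℤ v) → Before a b v
OccursBefore⇒Before {v = v} (p , s , eq , y∈) with OccursBefore-letters v p s eq y∈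
... | a′ , b′ , a′≡a , b′≡b , ab rewrite valℤ-injective a′≡a | valℤ-injective b′≡b = ab

Before⇒OccursBefore : Before a b v → OccursBefore (valℤ a) (valℤ b) (map valℤ v)
Before⇒OccursBefore {v = _ ∷ s} (now b∈) = [] , map valℤ s , refl , ∈P.∈-map⁺ valℤ b∈
Before⇒OccursBefore {v = c ∷ _} (later ab) with Before⇒OccursBefore ab
... | p , s , eq , y∈ = valℤ c ∷ p , s , cong (valℤ c ∷_) eq , y∈

module _ {k : ℕ} {β : Fin k → SkewShape} (no2x2 : ∀ i → No2x2 (β i)) where

  InW⇒unique : InW N k β v → Unique v
  InW⇒unique (v↭ , _) = UniqueP.map⁻ (unique-resp-↭ (↭.↭-sym v↭) (unique-shiftedContents k β no2x2))

  InW⇒cell : InW N k β v → a ∈ v → ∃[ i ] ∃[ z ] (z ∈S β i × shc k i z ≡ valℤ a)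
  InW⇒cell (v↭ , _) a∈ = ∈-shiftedContents⁻ k β (↭P.∈-resp-↭ v↭ (∈P.∈-map⁺ valℤ a∈))

  InW-⊆ : InW N k β u → InW N k β v → u ⊆ v
  InW-⊆ (u↭ , _) (v↭ , _) a∈ =
    let b , b∈ , eq = ∈P.∈-map⁻ valℤ (↭P.∈-resp-↭ (↭.↭-sym v↭) (↭P.∈-resp-↭ u↭ (∈P.∈-map⁺ valℤ a∈)))
    in subst (_∈ _) (valℤ-injective (sym eq)) b∈

  private
    consecutive⇒adjacent : ∀ {i j r c r′ c′} → (r , c) ∈S β i → (r′ , c′) ∈S β j →
      i ≡ j × content (r , c) ℤ.+ + 1 ≡ content (r′ , c′) →
      i ≡ j × (Adjacent (r , c) (r′ , c′) ⊎ Adjacent (r′ , c′) (r , c))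
    consecutive⇒adjacent {i} {r = r} {c} {r′} {c′} z∈ z′∈ (refl , step) =
      refl , consecutive-content⇒adjacent (β i) (no2x2 i) z∈ z′∈ (content-suc r c r′ c′ step)

    +k-shc : ∀ i j z z′ → val a + k ≡ val b → shc k i z ≡ valℤ a → shc k j z′ ≡ valℤ b →
             shc k i z ℤ.+ + k ≡ shc k j z′
    +k-shc {a = a} {b = b} i j z z′ a+k≡b za z′b = trans (cong (ℤ._+ + k) za) (trans (+k-valℤ {a = a} {b = b} a+k≡b) (sym z′b))

  KApart⇒adjacent : ∀ {i j z z′} → KApart k a b → z ∈S β i → z′ ∈S β j →
    shc k i z ≡ valℤ a → shc k j z′ ≡ valℤ b → i ≡ j × (Adjacent z z′ ⊎ Adjacent z′ z)
  KApart⇒adjacent {i = i} {j} {z} {z′} (inj₁ a+k≡b) z∈ z′∈ za z′b =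
    consecutive⇒adjacent z∈ z′∈ (shc-+k k i j z z′ (+k-shc i j z z′ a+k≡b za z′b))
  KApart⇒adjacent {i = i} {j} {z} {z′} (inj₂ b+k≡a) z∈ z′∈ za z′b with
    consecutive⇒adjacent z′∈ z∈ (shc-+k k j i z′ z (+k-shc j i z′ z b+k≡a z′b za))
  ... | refl , adj = refl , swap adj

  InW⇒KRearrangement : InW N k β w → InW N k β u → KRearrangement k w u
  InW⇒KRearrangement {w = w} {u = u} inW inU = InW⇒unique inU , InW-⊆ inU inW , InW-⊆ inW inU , order
    where
    forced : ∀ {a b i z z′} → InW N k β v → z ∈S β i → z′ ∈S β i → Adjacent z z′ →
             shc k i z ≡ valℤ a → shc k i z′ ≡ valℤ b → Before a b v
    forced inV z∈ z′∈ adj za z′b =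
      OccursBefore⇒Before (subst₂ (λ x y → OccursBefore x y _) za z′b (proj₂ inV _ _ _ z∈ z′∈ adj))
    order : KOrderPreserved k w u
    order a b apart ab with InW⇒cell inW (Before⇒∈ˡ ab) | InW⇒cell inW (Before⇒∈ʳ ab)
    ... | i , z , z∈ , za | j , z′ , z′∈ , z′b with KApart⇒adjacent apart z∈ z′∈ za z′b
    ...   | refl , inj₁ adj = forced inU z∈ z′∈ adj za z′b
    ...   | refl , inj₂ adj = contradiction (forced inW z′∈ z∈ adj z′b za) (Before-asym (InW⇒unique inW) ab)

  KRearrangement⇒InW : InW N k β w → KRearrangement k w u → InW N k β u
  KRearrangement⇒InW {w = w} {u = u} inW (uu , u⊆w , w⊆u , ord) = u↭ , order
    where
    u↭ : map valℤ u ↭ shiftedContents k β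
    u↭ = ↭.↭-trans (unique-↭ (UniqueP.map⁺ valℤ-injective uu) (UniqueP.map⁺ valℤ-injective (InW⇒unique inW))
                   (⊆P.map⁺ valℤ u⊆w) (⊆P.map⁺ valℤ w⊆u)) (proj₁ inW)
    order : ∀ i z z′ → z ∈S β i → z′ ∈S β i → Adjacent z z′ → OccursBefore (shc k i z) (shc k i z′) (map valℤ u)
    order i z z′ z∈ z′∈ adj with proj₂ inW i z z′ z∈ z′∈ adj
    ... | p , s , eq , y∈ with OccursBefore-letters w p s eq y∈
    ...   | a , b , a≡ , b≡ , ab = subst₂ (λ x y → OccursBefore x y (map valℤ u)) a≡ b≡
      (Before⇒OccursBefore (ord a b (apart (shc-adjacent k i z z′ adj)) ab))
      where
      apart : shc k i z ℤ.+ + k ≡ shc k i z′ ⊎ shc k i z′ ℤ.+ + k ≡ shc k i z → KApart k a b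
      apart (inj₁ h) = inj₁ (+k-val {a = a} {b = b} (trans (cong (ℤ._+ + k) a≡) (trans h (sym b≡))))
      apart (inj₂ h) = inj₂ (+k-val {a = b} {b = a} (trans (cong (ℤ._+ + k) b≡) (trans h (sym a≡))))

-- The tuple of ribbons read off a distinct word

isNo : {A : Set} → Dec A → ℕ
isNo (yes _) = 0
isNo (no _)  = 1

isNo≡0 : {A : Set} (d : Dec A) → isNo d ≡ 0 → A
isNo≡0 (yes a) _ = a

isNo≡1 : {A : Set} (d : Dec A) → isNo d ≡ 1 → ¬ A
isNo≡1 (no ¬a) _ = ¬a

isNo≤1 : {A : Set} (d : Dec A) → isNo d ≤ 1
isNo≤1 (yes _) = z≤n
isNo≤1 (no _)  = s≤s z≤n

-- Component i carries the letters of value k c + i, the letter of value k c + i sitting in the cell of content c.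
-- Going from content c to c + 1 is a south step if c is absent or the letter of c + 1 comes first in w, and an east
-- step otherwise. The row of content c counts the south steps after c.
module Ribbon {N k : ℕ} (w : Word N) (i : Fin k) where

  private instance
    k-nonZero : ℕ.NonZero k
    k-nonZero = ℕ.>-nonZero (ℕP.≤-<-trans z≤n (FinP.toℕ<n i))

  Present : ℕ → Set
  Present c = Any (λ a → val a ≡ k ℕ.* c + toℕ i) w

  present? : ∀ c → Dec (Present c)
  present? c = any? (λ a → val a ℕ.≟ k ℕ.* c + toℕ i) w

  letter : ∀ {c} → Present c → Fin N
  letter p = proj₁ (find p)

  letter∈ : ∀ {c} (p : Present c) → letter p ∈ w
  letter∈ p = proj₁ (proj₂ (find p))

  letter-val : ∀ {c} (p : Present c) → val (letter p) ≡ k ℕ.* c + toℕ i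
  letter-val p = proj₂ (proj₂ (find p))

  letter-unique : ∀ {c a} (p : Present c) → val a ≡ k ℕ.* c + toℕ i → letter p ≡ a
  letter-unique p eq = val-injective (trans (letter-val p) (sym eq))

  M : ℕ
  M = suc N

  present⇒<M : ∀ {c} → Present c → c < M
  present⇒<M {c} p = s≤s (begin
    c                ≤⟨ ℕP.m≤n*m c k ⟩
    k ℕ.* c          ≤⟨ ℕP.m≤m+n _ (toℕ i) ⟩
    k ℕ.* c + toℕ i  ≡⟨ letter-val p ⟨
    val (letter p)   ≤⟨ FinP.toℕ<n (letter p) ⟩
    N                ∎)
    where open ℕP.≤-Reasoning

  stepWith : ∀ {c} → Dec (Present c) → Dec (Present (suc c)) → ℕ
  stepWith (yes p) (yes q) = isNo (before? (letter p) (letter q) w)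
  stepWith (yes _) (no _)  = 0
  stepWith (no _)  _       = 1

  step : ℕ → ℕ
  step c = stepWith (present? c) (present? (suc c))

  step≤1 : ∀ c → step c ≤ 1
  step≤1 c = go (present? c) (present? (suc c))
    where
    go : (dp : Dec (Present c)) (dq : Dec (Present (suc c))) → stepWith dp dq ≤ 1
    go (yes p) (yes q) = isNo≤1 (before? (letter p) (letter q) w)
    go (yes _) (no _)  = z≤n
    go (no _)  _       = s≤s z≤n

  step-absent : ∀ c → ¬ Present c → step c ≡ 1
  step-absent c ¬p = go (present? c) (present? (suc c))
    where
    go : (dp : Dec (Present c)) (dq : Dec (Present (suc c))) → stepWith dp dq ≡ 1
    go (yes p) _ = contradiction p ¬p
    go (no _)  _ = refl

  step≡1⇒present : ∀ c → Present c → step c ≡ 1 → Present (suc c)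
  step≡1⇒present c p = go (present? c) (present? (suc c))
    where
    go : (dp : Dec (Present c)) (dq : Dec (Present (suc c))) → stepWith dp dq ≡ 1 → Present (suc c)
    go _       (yes q) _  = q
    go (yes _) (no _)  ()
    go (no ¬p) (no _)  _  = contradiction p ¬p

  step≡0⇒before : ∀ c {a a′} → a ∈ w → a′ ∈ w → val a ≡ k ℕ.* c + toℕ i → val a′ ≡ k ℕ.* suc c + toℕ i →
    step c ≡ 0 → Before a a′ w
  step≡0⇒before c {a} {a′} a∈ a′∈ va va′ = go (present? c) (present? (suc c))
    where
    go : (dp : Dec (Present c)) (dq : Dec (Present (suc c))) → stepWith dp dq ≡ 0 → Before a a′ w
    go (yes p) (yes q) s≡0 rewrite sym (letter-unique p va) | sym (letter-unique q va′) =
      isNo≡0 (before? (letter p) (letter q) w) s≡0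
    go (yes _) (no ¬q) _ = contradiction (lose a′∈ va′) ¬q
    go (no _)  _       ()

  step≡1⇒before : ∀ c {a a′} → a ∈ w → a′ ∈ w → val a ≡ k ℕ.* c + toℕ i → val a′ ≡ k ℕ.* suc c + toℕ i →
    step c ≡ 1 → Before a′ a w
  step≡1⇒before c {a} {a′} a∈ a′∈ va va′ = go (present? c) (present? (suc c))
    where
    a≢a′ : a ≢ a′
    a≢a′ refl = ℕP.<-irrefl (trans (sym va) va′) (ℕP.+-monoˡ-< (toℕ i) (ℕP.*-monoʳ-< k (ℕP.n<1+n c)))
    go : (dp : Dec (Present c)) (dq : Dec (Present (suc c))) → stepWith dp dq ≡ 1 → Before a′ a w
    go (yes p) (yes q) s≡1 with Before-total a∈ a′∈ a≢a′
    ... | inj₂ a′a = a′a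
    ... | inj₁ aa′ rewrite sym (letter-unique p va) | sym (letter-unique q va′) =
      contradiction aa′ (isNo≡1 (before? (letter p) (letter q) w) s≡1)
    go (yes _) (no _)  ()
    go (no ¬p) _       _ = contradiction (lose a∈ va) ¬p

  rowFrom : ℕ → ℕ → ℕ
  rowFrom zero    c = 0
  rowFrom (suc n) c = step c + rowFrom n (suc c)

  row : ℕ → ℕ
  row c = rowFrom (M ∸ c) c

  row-step : ∀ {c} → c < M → row c ≡ step c + row (suc c)
  row-step (s≤s c≤N) rewrite ℕP.+-∸-assoc 1 c≤N = refl

  row-beyond : ∀ {c} → M ≤ c → row c ≡ 0
  row-beyond M≤c rewrite ℕP.m≤n⇒m∸n≡0 M≤c = refl

  row≤M : ∀ c → row c ≤ M
  row≤M c = ℕP.≤-trans (bounded (M ∸ c) c) (ℕP.m∸n≤m M c)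
    where
    bounded : ∀ n c → rowFrom n c ≤ n
    bounded zero    c = z≤n
    bounded (suc n) c = ℕP.+-mono-≤ (step≤1 c) (bounded n (suc c))

  row-antitone : ∀ {c c′} → c ≤ c′ → row c′ ≤ row c
  row-antitone = antitone-by-steps row suc-step
    where
    suc-step : ∀ c → row (suc c) ≤ row c
    suc-step c with c ℕ.<? M
    ... | yes c<M = subst (row (suc c) ≤_) (sym (row-step c<M)) (ℕP.m≤n+m _ (step c))
    ... | no c≮M  =
      ℕP.≤-reflexive (trans (row-beyond (ℕP.m≤n⇒m≤1+n (ℕP.≮⇒≥ c≮M))) (sym (row-beyond (ℕP.≮⇒≥ c≮M))))

  absent⇒row-drop : ∀ {c c′} → c < c′ → c′ < M → ¬ Present c → row c′ < row c
  absent⇒row-drop {c} c<c′ c′<M ¬p = ℕP.≤-trans (s≤s (row-antitone c<c′))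
    (ℕP.≤-reflexive (trans (cong (_+ row (suc c)) (sym (step-absent c ¬p))) (sym (row-step (ℕP.<-trans c<c′ c′<M)))))

  col : ℕ → ℕ
  col c = c + row c

  col-monotone : ∀ {c c′} → c ≤ c′ → col c ≤ col c′
  col-monotone = monotone-by-steps col suc-step
    where
    suc-step : ∀ c → col c ≤ col (suc c)
    suc-step c with c ℕ.<? M
    ... | yes c<M rewrite row-step c<M = begin
      c + (step c + row (suc c))   ≡⟨ ℕP.+-assoc c (step c) _ ⟨
      c + step c + row (suc c)     ≤⟨ ℕP.+-monoˡ-≤ (row (suc c)) (ℕP.+-monoʳ-≤ c (step≤1 c)) ⟩
      c + 1 + row (suc c)          ≡⟨ cong (_+ row (suc c)) (ℕP.+-comm c 1) ⟩
      suc c + row (suc c)          ∎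
      where open ℕP.≤-Reasoning
    ... | no c≮M rewrite row-beyond (ℕP.≮⇒≥ c≮M) | row-beyond (ℕP.m≤n⇒m≤1+n (ℕP.≮⇒≥ c≮M)) =
      ℕP.+-monoˡ-≤ 0 (ℕP.n≤1+n c)

  -- Equal columns at d and d + 1 force a south step at d, and a south step from a present content reaches a present one.
  flat-col⇒present : ∀ n {d} → Present d → col (d + n) ≡ col d → Present (d + n)
  flat-col⇒present zero    {d} p _  = subst Present (sym (ℕP.+-identityʳ d)) p
  flat-col⇒present (suc n) {d} p eq = subst Present (sym (ℕP.+-suc d n))
    (flat-col⇒present n (step≡1⇒present d p step≡1) (trans (cong col (sym (ℕP.+-suc d n))) (trans eq (sym col-suc≡))))
    where
    col-suc≡ : col (suc d) ≡ col d
    col-suc≡ = ℕP.≤-antisym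
      (ℕP.≤-trans (col-monotone (ℕP.≤-trans (s≤s (ℕP.m≤m+n d n)) (ℕP.≤-reflexive (sym (ℕP.+-suc d n))))) (ℕP.≤-reflexive eq))
      (col-monotone (ℕP.n≤1+n d))
    step≡1 : step d ≡ 1
    step≡1 = ℕP.+-cancelʳ-≡ (row (suc d)) (step d) 1 (ℕP.+-cancelˡ-≡ d _ _ (begin
      d + (step d + row (suc d))   ≡⟨ cong (_+_ d) (row-step (present⇒<M p)) ⟨
      col d                        ≡⟨ col-suc≡ ⟨
      suc d + row (suc d)          ≡⟨ ℕP.+-suc d (row (suc d)) ⟨
      d + (1 + row (suc d))        ∎))
      where open ≡-Reasoning

  -- Row r of the shape runs from the leftmost cell in rows ≤ r to the rightmost cell in rows ≥ r.
  InnerCandidate OuterCandidate : ℕ → ℕ → Set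
  InnerCandidate r c = Present c × row c ≤ r
  OuterCandidate r c = Present c × r ≤ row c

  innerCandidate? : ∀ r c → Dec (InnerCandidate r c)
  innerCandidate? r c = present? c ×-dec (row c ℕ.≤? r)

  outerCandidate? : ∀ r c → Dec (OuterCandidate r c)
  outerCandidate? r c = present? c ×-dec (r ℕ.≤? row c)

  innerCols outerCols : ℕ → List ℕ
  innerCols r = map col (filter (innerCandidate? r) (upTo M))
  outerCols r = map (suc ∘ col) (filter (outerCandidate? r) (upTo M))

  innerCol outerCol : ℕ → ℕ
  innerCol r = ℕExtrema.min (M + M) (innerCols r)
  outerCol r = ℕExtrema.max 0 (outerCols r)

  private
    candidate∈ : ∀ {Q : ℕ → Set} (Q? : ∀ c → Dec (Q c)) (f : ℕ → ℕ) {c} → Present c → Q c →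
                 f c ∈ map f (filter Q? (upTo M))
    candidate∈ Q? f p q = ∈P.∈-map⁺ f (∈P.∈-filter⁺ Q? (∈-upTo⁺ (present⇒<M p)) q)

    selected : ∀ {Q : ℕ → Set} (Q? : ∀ c → Dec (Q c)) (f : ℕ → ℕ) {v} →
               v ∈ map f (filter Q? (upTo M)) → ∃[ c ] (Q c × v ≡ f c)
    selected Q? f v∈ with ∈P.∈-map⁻ f v∈
    ... | c , c∈ , refl = c , proj₂ (∈P.∈-filter⁻ Q? c∈) , refl

  innerCol-≤ : ∀ {r c} → InnerCandidate r c → innerCol r ≤ col c
  innerCol-≤ (p , le) = ℕExtrema.min≤v⁺ (M + M) _ (inj₂ (lose (candidate∈ (innerCandidate? _) col p (p , le)) ℕP.≤-refl))

  outerCol-≥ : ∀ {r c} → OuterCandidate r c → col c < outerCol r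
  outerCol-≥ (p , le) = ℕExtrema.v≤max⁺ 0 _ (inj₂ (lose (candidate∈ (outerCandidate? _) (suc ∘ col) p (p , le)) ℕP.≤-refl))

  innerCol-attained : ∀ r → innerCol r ≡ M + M ⊎ ∃[ c ] (InnerCandidate r c × innerCol r ≡ col c)
  innerCol-attained r with ℕExtrema.argmin-sel id (M + M) (innerCols r)
  ... | inj₁ default = inj₁ default
  ... | inj₂ v∈      = inj₂ (selected (innerCandidate? r) col v∈)

  outerCol-attained : ∀ r → outerCol r ≡ 0 ⊎ ∃[ c ] (OuterCandidate r c × outerCol r ≡ suc (col c))
  outerCol-attained r with ℕExtrema.argmax-sel id 0 (outerCols r)
  ... | inj₁ default = inj₁ default
  ... | inj₂ v∈      = inj₂ (selected (outerCandidate? r) (suc ∘ col) v∈)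

  innerCol-antitone : ∀ r → innerCol (suc r) ≤ innerCol r
  innerCol-antitone r = ℕExtrema.min-mono-⊆ {xs = innerCols (suc r)} {ys = innerCols r} ℕP.≤-refl
    (⊆P.map⁺ col (⊆P.filter⁺′ (innerCandidate? r) (innerCandidate? (suc r)) (λ (p , le) → p , ℕP.m≤n⇒m≤1+n le) id))

  outerCol-antitone : ∀ r → outerCol (suc r) ≤ outerCol r
  outerCol-antitone r = ℕExtrema.max-mono-⊆ {xs = outerCols (suc r)} {ys = outerCols r} ℕP.≤-refl
    (⊆P.map⁺ (suc ∘ col) (⊆P.filter⁺′ (outerCandidate? (suc r)) (outerCandidate? r)
      (λ (p , le) → p , ℕP.≤-trans (ℕP.n≤1+n r) le) id))

  rightEnd : ℕ → ℕ
  rightEnd r = innerCol r ℕ.⊔ outerCol r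

  rows : ℕ
  rows = suc M

  shape : SkewShape
  shape = record
    { outer     = applyUpTo rightEnd rows
    ; inner     = applyUpTo innerCol rows
    ; outerPart = applyUpTo-linked rightEnd rows (λ r → ℕP.⊔-mono-≤ (innerCol-antitone r) (outerCol-antitone r))
    ; innerPart = applyUpTo-linked innerCol rows innerCol-antitone
    ; contained = contained
    }
    where
    contained : ∀ r → part (applyUpTo innerCol rows) r ≤ part (applyUpTo rightEnd rows) r
    contained r with r ℕ.<? rows
    ... | yes r<rows rewrite part-applyUpTo innerCol rows r r<rows | part-applyUpTo rightEnd rows r r<rows =
      ℕP.m≤m⊔n (innerCol r) (outerCol r)
    ... | no r≮rows rewrite part-applyUpTo-beyond innerCol rows r (ℕP.≮⇒≥ r≮rows)
                          | part-applyUpTo-beyond rightEnd rows r (ℕP.≮⇒≥ r≮rows) = z≤n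

  cell-of-present : ∀ {c} → Present c → (row c , col c) ∈S shape
  cell-of-present {c} p =
    subst (_≤ col c) (sym (part-applyUpTo innerCol rows (row c) (s≤s (row≤M c)))) (innerCol-≤ (p , ℕP.≤-refl)) ,
    subst (col c <_) (sym (part-applyUpTo rightEnd rows (row c) (s≤s (row≤M c))))
      (ℕP.≤-trans (outerCol-≥ (p , ℕP.≤-refl)) (ℕP.m≤n⊔m (innerCol (row c)) (outerCol (row c))))

  private
    same-row-between : ∀ {r x c′ c″} → OuterCandidate r c′ → x ≤ col c′ → InnerCandidate r c″ → col c″ ≤ x →
      c″ ≤ c′ → ∃[ c ] (Present c × row c ≡ r × x ≡ c + r)
    same-row-between {r} {x} {c′} {c″} (p′ , r≤row′) x≤col′ (_ , row″≤r) col″≤x c″≤c′ = c , present , row≡ , x≡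
      where
      row′≡ : row c′ ≡ r
      row′≡ = ℕP.≤-antisym (ℕP.≤-trans (row-antitone c″≤c′) row″≤r) r≤row′
      row″≡ : row c″ ≡ r
      row″≡ = ℕP.≤-antisym row″≤r (ℕP.≤-trans r≤row′ (row-antitone c″≤c′))
      r≤x : r ≤ x
      r≤x = ℕP.≤-trans (ℕP.m≤n+m r c″) (subst (λ t → c″ + t ≤ x) row″≡ col″≤x)
      c : ℕ
      c = x ∸ r
      x≡ : x ≡ c + r
      x≡ = sym (ℕP.m∸n+n≡m r≤x)
      c″≤c : c″ ≤ c
      c″≤c = ℕP.+-cancelʳ-≤ r c″ c (subst₂ _≤_ (cong (_+_ c″) row″≡) x≡ col″≤x)
      c≤c′ : c ≤ c′
      c≤c′ = ℕP.+-cancelʳ-≤ r c c′ (subst₂ _≤_ x≡ (cong (_+_ c′) row′≡) x≤col′)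
      row≡ : row c ≡ r
      row≡ = ℕP.≤-antisym (subst (row c ≤_) row″≡ (row-antitone c″≤c)) (subst (_≤ row c) row′≡ (row-antitone c≤c′))
      present : Present c
      present with present? c | c ℕ.≟ c′
      ... | yes p  | _         = p
      ... | no _   | yes refl  = p′
      ... | no ¬p  | no c≢c′  = contradiction (trans row′≡ (sym row≡))
                                  (ℕP.<⇒≢ (absent⇒row-drop (ℕP.≤∧≢⇒< c≤c′ c≢c′) (present⇒<M p′) ¬p))

    same-col-between : ∀ {r x c′ c″} → OuterCandidate r c′ → x ≤ col c′ → InnerCandidate r c″ → col c″ ≤ x →
      c′ < c″ → ∃[ c ] (Present c × row c ≡ r × x ≡ c + r)
    same-col-between {r} {x} {c′} {c″} (p′ , r≤row′) x≤col′ (_ , row″≤r) col″≤x c′<c″ = c , present , row≡ , x≡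
      where
      col′≡ : col c′ ≡ x
      col′≡ = ℕP.≤-antisym (ℕP.≤-trans (col-monotone (ℕP.<⇒≤ c′<c″)) col″≤x) x≤col′
      col″≡ : col c″ ≡ x
      col″≡ = ℕP.≤-antisym col″≤x (ℕP.≤-trans x≤col′ (col-monotone (ℕP.<⇒≤ c′<c″)))
      r≤x : r ≤ x
      r≤x = ℕP.≤-trans r≤row′ (ℕP.≤-trans (ℕP.m≤n+m (row c′) c′) (ℕP.≤-reflexive col′≡))
      c : ℕ
      c = x ∸ r
      x≡ : x ≡ c + r
      x≡ = sym (ℕP.m∸n+n≡m r≤x)
      c′≤c : c′ ≤ c
      c′≤c = ℕP.+-cancelʳ-≤ r c′ c (ℕP.≤-trans (ℕP.+-monoʳ-≤ c′ r≤row′) (ℕP.≤-reflexive (trans col′≡ x≡)))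
      c≤c″ : c ≤ c″
      c≤c″ = ℕP.+-cancelʳ-≤ r c c″ (ℕP.≤-trans (ℕP.≤-reflexive (trans (sym x≡) (sym col″≡))) (ℕP.+-monoʳ-≤ c″ row″≤r))
      col≡ : col c ≡ x
      col≡ = ℕP.≤-antisym (subst (col c ≤_) col″≡ (col-monotone c≤c″)) (subst (_≤ col c) col′≡ (col-monotone c′≤c))
      row≡ : row c ≡ r
      row≡ = ℕP.+-cancelˡ-≡ c (row c) r (trans col≡ x≡)
      present : Present c
      present = subst Present (ℕP.m+[n∸m]≡n c′≤c)
        (flat-col⇒present (c ∸ c′) p′ (trans (cong col (ℕP.m+[n∸m]≡n c′≤c)) (trans col≡ (sym col′≡))))

    below-outerCol : ∀ {r x} → innerCol r ≤ x → x < rightEnd r → x < outerCol r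
    below-outerCol {r} {x} inner≤x x<right with ℕP.⊔-sel (innerCol r) (outerCol r)
    ... | inj₁ ⊔≡inner = contradiction (subst (x <_) ⊔≡inner x<right) (ℕP.≤⇒≯ inner≤x)
    ... | inj₂ ⊔≡outer = subst (x <_) ⊔≡outer x<right

    below-col : ∀ {r x c′} → innerCol r ≤ x → x < rightEnd r → outerCol r ≡ suc (col c′) → x ≤ col c′
    below-col {x = x} inner≤x x<right outer≡ = ℕP.≤-pred (subst (x <_) outer≡ (below-outerCol inner≤x x<right))

    present-in-row : ∀ {r x} → innerCol r ≤ x → x < rightEnd r → ∃[ c ] (Present c × row c ≡ r × x ≡ c + r)
    present-in-row {r} {x} inner≤x x<right with outerCol-attained r | innerCol-attained r
    ... | inj₁ outer≡0 | _ = contradiction (subst (x <_) outer≡0 (below-outerCol inner≤x x<right)) λ ()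
    ... | inj₂ (c′ , cand′ , outer≡) | inj₁ inner≡M+M =
      contradiction (ℕP.≤-trans (subst (_≤ x) inner≡M+M inner≤x) (below-col {c′ = c′} inner≤x x<right outer≡))
                    (ℕP.<⇒≱ (ℕP.+-mono-<-≤ (present⇒<M (proj₁ cand′)) (row≤M c′)))
    ... | inj₂ (c′ , cand′ , outer≡) | inj₂ (c″ , cand″ , inner≡) with c″ ℕ.≤? c′
    ...   | yes c″≤c′ = same-row-between cand′ (below-col {c′ = c′} inner≤x x<right outer≡)
                                         cand″ (subst (_≤ x) inner≡ inner≤x) c″≤c′
    ...   | no c″≰c′  = same-col-between cand′ (below-col {c′ = c′} inner≤x x<right outer≡)
                                         cand″ (subst (_≤ x) inner≡ inner≤x) (ℕP.≰⇒> c″≰c′)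

  present-of-cell : ∀ {r x} → (r , x) ∈S shape → ∃[ c ] (Present c × row c ≡ r × x ≡ c + r)
  present-of-cell {r} {x} (inner≤x , x<outer) with r ℕ.<? rows
  ... | no r≮rows = contradiction (subst (x <_) (part-applyUpTo-beyond rightEnd rows r (ℕP.≮⇒≥ r≮rows)) x<outer) λ ()
  ... | yes r<rows = present-in-row (subst (_≤ x) (part-applyUpTo innerCol rows r r<rows) inner≤x)
                                    (subst (x <_) (part-applyUpTo rightEnd rows r r<rows) x<outer)

  shc-of-cell : ∀ c r → shc k i (r , c + r) ≡ + (k ℕ.* c + toℕ i)
  shc-of-cell c r = begin
    + k ℤ.* (+ (c + r) ℤ.- + r) ℤ.+ + toℕ i   ≡⟨ cong (λ t → + k ℤ.* (t ℤ.- + r) ℤ.+ + toℕ i) (ℤP.pos-+ c r) ⟩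
    + k ℤ.* (+ c ℤ.+ + r ℤ.- + r) ℤ.+ + toℕ i ≡⟨ cancel (+ k) (+ c) (+ r) (+ toℕ i) ⟩
    + k ℤ.* + c ℤ.+ + toℕ i                   ≡⟨ cong (ℤ._+ + toℕ i) (ℤP.pos-* k c) ⟨
    + (k ℕ.* c) ℤ.+ + toℕ i                   ≡⟨ ℤP.pos-+ (k ℕ.* c) (toℕ i) ⟨
    + (k ℕ.* c + toℕ i)                       ∎
    where
    open ≡-Reasoning
    cancel : ∀ K c r I → K ℤ.* (c ℤ.+ r ℤ.- r) ℤ.+ I ≡ K ℤ.* c ℤ.+ I
    cancel = ℤSolver.solve-∀

  letter-shc : ∀ {c r x} (p : Present c) → x ≡ c + r → valℤ (letter p) ≡ shc k i (r , x)
  letter-shc {c} {r} p refl = trans (cong +_ (letter-val p)) (sym (shc-of-cell c r))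

  no2x2 : No2x2 shape
  no2x2 r x (z , _ , _ , z′) with present-of-cell z | present-of-cell z′
  ... | c , _ , row≡ , x≡ | c′ , _ , row≡′ , x≡′ = ℕP.<-irrefl (trans (sym row≡) (trans (cong row c≡c′) row≡′)) (ℕP.n<1+n r)
    where
    c≡c′ : c ≡ c′
    c≡c′ = ℕP.+-cancelʳ-≡ r c c′ (trans (sym x≡) (ℕP.suc-injective (trans x≡′ (ℕP.+-suc c′ r))))

  adjacent⇒before : ∀ z z′ → z ∈S shape → z′ ∈S shape → Adjacent z z′ →
    OccursBefore (shc k i z) (shc k i z′) (map valℤ w)
  adjacent⇒before (r , x) (_ , _) z∈ z′∈ (inj₁ (refl , refl)) with present-of-cell z∈ | present-of-cell z′∈
  ... | c , p , row≡ , x≡ | c′ , p′ , row≡′ , x≡′ =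
    subst₂ (λ s t → OccursBefore s t (map valℤ w)) (letter-shc p x≡) (letter-shc p′ x≡′)
      (Before⇒OccursBefore (step≡0⇒before c (letter∈ p) (letter∈ p′) (letter-val p)
        (subst (λ t → val (letter p′) ≡ k ℕ.* t + toℕ i) c′≡ (letter-val p′)) east))
    where
    c′≡ : c′ ≡ suc c
    c′≡ = ℕP.+-cancelʳ-≡ r c′ (suc c) (trans (sym x≡′) (cong suc x≡))
    east : step c ≡ 0
    east = ℕP.+-cancelʳ-≡ r (step c) 0 (trans (sym (cong (_+_ (step c)) (trans (sym (cong row c′≡)) row≡′)))
             (trans (sym (row-step (present⇒<M p))) row≡))
  adjacent⇒before (r , x) (_ , _) z∈ z′∈ (inj₂ (refl , refl)) with present-of-cell z∈ | present-of-cell z′∈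
  ... | c , p , row≡ , x≡ | c′ , p′ , row≡′ , x≡′ =
    subst₂ (λ s t → OccursBefore s t (map valℤ w)) (letter-shc p x≡) (letter-shc p′ x≡′)
      (Before⇒OccursBefore (step≡1⇒before c′ (letter∈ p′) (letter∈ p) (letter-val p′)
        (subst (λ t → val (letter p) ≡ k ℕ.* t + toℕ i) c≡ (letter-val p)) south))
    where
    c≡ : c ≡ suc c′
    c≡ = ℕP.+-cancelʳ-≡ r c (suc c′) (trans (sym x≡) (trans x≡′ (ℕP.+-suc c′ r)))
    south : step c′ ≡ 1
    south = ℕP.+-cancelʳ-≡ r (step c′) 1 (trans (sym (cong (_+_ (step c′)) (trans (sym (cong row c≡)) row≡)))
              (trans (sym (row-step (present⇒<M p′))) row≡′))

  shc-in-range : ∀ z → z ∈S shape → + 1 ℤ.≤ shc k i z × shc k i z ℤ.≤ + N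
  shc-in-range (r , x) z∈ with present-of-cell {r} {x} z∈
  ... | c , p , _ , x≡ =
    subst (+ 1 ℤ.≤_) (letter-shc p x≡) (ℤ.+≤+ (s≤s z≤n)) ,
    subst (ℤ._≤ + N) (letter-shc p x≡) (ℤ.+≤+ (FinP.toℕ<n (letter p)))

ribbons : Word N → Fin k → SkewShape
ribbons w i = Ribbon.shape w i

ribbons-admissible : (w : Word N) → Admissible N k (ribbons w)
ribbons-admissible w i = Ribbon.no2x2 w i , Ribbon.shc-in-range w i

-- A letter's component and content are the remainder and quotient of its value by k.
letter∈ribbons : .{{_ : ℕ.NonZero k}} → a ∈ w → valℤ a ∈ shiftedContents k (ribbons w)
letter∈ribbons {k = k} {a = a} {w = w} a∈ =
  subst (_∈ shiftedContents k (ribbons w))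
    (trans (Ribbon.shc-of-cell w i q (Ribbon.row w i q)) (cong +_ (sym value)))
    (∈-shiftedContents⁺ k (ribbons w) i (Ribbon.row w i q , Ribbon.col w i q)
      (Ribbon.cell-of-present w i (lose a∈ value)))
  where
  q : ℕ
  q = val a DivMod./ k
  i : Fin k
  i = Fin.fromℕ< (DivMod.m%n<n (val a) k)
  value : val a ≡ k ℕ.* q + toℕ i
  value = begin
    val a                       ≡⟨ DivMod.m≡m%n+[m/n]*n (val a) k ⟩
    val a DivMod.% k + q ℕ.* k  ≡⟨ ℕP.+-comm _ (q ℕ.* k) ⟩
    q ℕ.* k + val a DivMod.% k  ≡⟨ cong₂ _+_ (ℕP.*-comm q k) (sym (FinP.toℕ-fromℕ< _)) ⟩
    k ℕ.* q + toℕ i             ∎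
    where open ≡-Reasoning

shiftedContents⊆letters : (w : Word N) → shiftedContents k (ribbons w) ⊆ map valℤ w
shiftedContents⊆letters {k = k} w {x} x∈ = letter-of-cell (∈-shiftedContents⁻ k (ribbons w) x∈)
  where
  letter-of-cell : ∃[ i ] ∃[ z ] (z ∈S ribbons w i × shc k i z ≡ x) → x ∈ map valℤ w
  letter-of-cell (i , (r , y) , z∈ , shc≡x) =
    let c , p , _ , y≡ = Ribbon.present-of-cell w i {r} {y} z∈
    in subst (_∈ map valℤ w) (trans (Ribbon.letter-shc w i p y≡) shc≡x) (∈P.∈-map⁺ valℤ (Ribbon.letter∈ w i p))

letters⊆shiftedContents : .{{_ : ℕ.NonZero k}} (w : Word N) → map valℤ w ⊆ shiftedContents k (ribbons w)
letters⊆shiftedContents {k = k} w x∈ =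
  let a , a∈ , x≡ = ∈P.∈-map⁻ valℤ x∈ in subst (_∈ shiftedContents k (ribbons w)) (sym x≡) (letter∈ribbons a∈)

ribbons-InW : .{{_ : ℕ.NonZero k}} → Unique w → InW N k (ribbons w) w
ribbons-InW {k = k} {w = w} uw =
  unique-↭ {xs = map valℤ w} {ys = shiftedContents k (ribbons w)} (UniqueP.map⁺ valℤ-injective uw)
    (unique-shiftedContents k (ribbons w) (λ i → proj₁ (ribbons-admissible w i)))
    (letters⊆shiftedContents w) (shiftedContents⊆letters {k = k} w) ,
  λ i → Ribbon.adjacent⇒before {k = k} w i

InJ⇔InW : ∀ {β : Fin k → SkewShape} {v₀ : Word N} → (∀ i → No2x2 (β i)) → InW N k β v₀ →
  ∀ v → InJ N k (v ⊖ v₀) ⇔ (InW N k β v × inv k v ≡ inv k v₀)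
InJ⇔InW {β = β} {v₀} no2x2 inW₀ v = mk⇔
  (λ ij → let r , inv≡ = ideal⇒KRearrangement unique₀ ij in KRearrangement⇒InW {β = β} no2x2 inW₀ r , inv≡)
  (λ (inW , inv≡) → KRearrangement⇒InJ unique₀ (InW⇒KRearrangement {β = β} no2x2 inW₀ inW) inv≡)
  where
  unique₀ : Unique v₀
  unique₀ = InW⇒unique {β = β} no2x2 inW₀

IsWClass : (N k : ℕ) → (Word N → Set) → Set
IsWClass N k C = ∃[ β ] ∃[ t ] (Admissible N k β × (∃[ v ] (InW N k β v × inv k v ≡ t)) ×
  (∀ v → C v ⇔ (InW N k β v × inv k v ≡ t)))

nonzeroClass⇒WClass : ∀ {C : Word N → Set} .{{_ : ℕ.NonZero k}} → IsNonzeroClass N k C → IsWClass N k C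
nonzeroClass⇒WClass {k = k} ((w , C⇔) , nonzero) =
  ribbons w , inv k w , ribbons-admissible w , (w , inW , refl) ,
  λ v → ⇔.trans (C⇔ v) (InJ⇔InW {β = ribbons w} (λ i → proj₁ (ribbons-admissible w i)) inW v)
  where
  inW : InW _ k (ribbons w) w
  inW = ribbons-InW (nonzero⇒unique (nonzero w (Equivalence.from (C⇔ w) (Congruent⇒InJ (Congruent-refl _)))))

WClass⇒nonzeroClass : ∀ {C : Word N → Set} → IsWClass N k C → IsNonzeroClass N k C
WClass⇒nonzeroClass (β , _ , admissible , (v₀ , inW₀ , refl) , C⇔) =
  (v₀ , λ v → ⇔.trans (C⇔ v) (⇔.sym (InJ⇔InW {β = β} (λ i → proj₁ (admissible i)) inW₀ v))) ,
  λ v Cv → unique⇒nonzero (InW⇒unique {β = β} (λ i → proj₁ (admissible i)) (proj₁ (Equivalence.to (C⇔ v) Cv)))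

proposition5p5 : (N k : ℕ) → 1 ≤ k → (C : Word N → Set) →
    IsNonzeroClass N k C ⇔
      (∃[ β ] ∃[ t ] (Admissible N k β × (∃[ v ] (InW N k β v × inv k v ≡ t)) ×
        (∀ v → C v ⇔ (InW N k β v × inv k v ≡ t))))
proposition5p5 N k 1≤k C = mk⇔ (nonzeroClass⇒WClass {{ℕ.>-nonZero 1≤k}}) WClass⇒nonzeroClass
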